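{- Let $r\ge 1$ and let $M=(v_1,\dots,v_n)$ be a list (repetitions allowed) of nonzero vectors of $\mathbb{F}_2^r$ that generates $\mathbb{F}_2^r$, and let $G=G(\mathbb{F}_2^r,M)$ be the associated Cayley multigraph. Suppose $M$ is generic, i.e. $\sum_{i=1}^n v_i\neq \mathbf{0}$ in $\mathbb{F}_2^r$. Then the Sylow-$2$ subgroup of the sandpile group $K(G)$ is a direct sum of exactly $2^{r-1}-1$ nontrivial cyclic groups; equivalently $K(G)\otimes \mathbb{Z}/2\mathbb{Z}\cong(\mathbb{Z}/2\mathbb{Z})^{2^{r-1}-1}$.
   Context: The Cayley graph $G(\mathbb{F}_2^r,M)$ has vertex set $\mathbb{F}_2^r$ and, for each vertex $w$ and each index $i$, one edge joining $w$ and $w+v_i$ (so it is an undirected $n$-regular multigraph without loops, connected since $M$ generates). Its Laplacian $L(G)$ is the $2^r\times 2^r$ integer matrix with diagonal entries $n$ and off-diagonal entry $-m(u,v)$, where $m(u,v)$ is the number of edges between $u$ and $v$. Viewing $L(G):\mathbb{Z}^{2^r}\to\mathbb{Z}^{2^r}$, one has $\operatorname{coker}L(G)\cong \mathbb{Z}\oplus K(G)$ with $K(G)$ a finite abelian group, the sandpile group. The number of Sylow-$2$ cyclic factors is the number of cyclic factors of $2$-power order $>1$ in a decomposition of the Sylow-$2$ subgroup of $K(G)$ into cyclic groups of prime power order. -}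

module Defs where

open import Data.Nat as ℕ using (ℕ; zero; suc)
open import Data.Bool using (Bool; true; false; _xor_; if_then_else_)
open import Data.Bool.Properties using () renaming (_≟_ to _≟B_)
open import Data.Vec using (Vec; []; _∷_; zipWith; replicate)
open import Data.Vec.Properties using (≡-dec)
open import Data.List using (List; []; _∷_; map; _++_)
open import Data.Integer as ℤ using (ℤ; +_)
open import Data.Product using (Σ; ∃; _×_; _,_)
open import Relation.Nullary using (Dec; does; ¬_)
open import Relation.Binary.PropositionalEquality using (_≡_)

F2 : ℕ → Set
F2 r = Vec Bool r

_≟V_ : ∀ {r} (u v : F2 r) → Dec (u ≡ v)
_≟V_ = ≡-dec _≟B_

_⊕_ : ∀ {r} → F2 r → F2 r → F2 r
_⊕_ = zipWith _xor_

𝟎 : ∀ {r} → F2 r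
𝟎 = replicate _ false

sumList : ∀ {r n} → Vec (F2 r) n → F2 r
sumList []       = 𝟎
sumList (v ∷ M) = v ⊕ sumList M

subsetSum : ∀ {r n} → Vec Bool n → Vec (F2 r) n → F2 r
subsetSum []          []      = 𝟎
subsetSum (true ∷ S)  (v ∷ M) = v ⊕ subsetSum S M
subsetSum (false ∷ S) (v ∷ M) = subsetSum S M

-- M generates F₂^r (over F₂, spans = every vector is a subset sum)
Generates : ∀ {r n} → Vec (F2 r) n → Set
Generates {r} {n} M = ∀ (w : F2 r) → ∃ λ (S : Vec Bool n) → w ≡ subsetSum S M

AllNonzero : ∀ {r n} → Vec (F2 r) n → Set
AllNonzero [] = Data.Unit.⊤ where import Data.Unit
AllNonzero (v ∷ M) = (¬ v ≡ 𝟎) × AllNonzero M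

allVecs : (r : ℕ) → List (F2 r)
allVecs zero    = [] ∷ []
allVecs (suc r) = map (false ∷_) (allVecs r) ++ map (true ∷_) (allVecs r)

-- m(u,v): number of edges of G(F₂^r, M) between u and v,
-- i.e. number of indices i with u + vᵢ = v
mult : ∀ {r n} → Vec (F2 r) n → F2 r → F2 r → ℕ
mult []      u v = 0
mult (m ∷ M) u v = (if does ((u ⊕ m) ≟V v) then 1 else 0) ℕ.+ mult M u v

lap : ∀ {r n} → Vec (F2 r) n → F2 r → F2 r → ℤ
lap {n = n} M u v = if does (u ≟V v) then + n else ℤ.- (+ mult M u v)

ZVec : ℕ → Set
ZVec r = F2 r → ℤ

sumℤ : List ℤ → ℤ
sumℤ []       = + 0
sumℤ (x ∷ xs) = x ℤ.+ sumℤ xs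

applyL : ∀ {r n} → Vec (F2 r) n → ZVec r → ZVec r
applyL {r} M x u = sumℤ (map (λ v → lap M u v ℤ.* x v) (allVecs r))

InImL : ∀ {r n} → Vec (F2 r) n → ZVec r → Set
InImL {r} M x = ∃ λ (z : ZVec r) → ∀ u → x u ≡ applyL M z u

-- the class of x in coker L(G) is a torsion element, i.e. lies in K(G)
InK : ∀ {r n} → Vec (F2 r) n → ZVec r → Set
InK M x = ∃ λ (m : ℕ) → InImL M (λ u → + suc m ℤ.* x u)

-- x ∈ im L + 2·(torsion lift), i.e. the class of x in K(G) lies in 2K(G)
InIm+2K : ∀ {r n} → Vec (F2 r) n → ZVec r → Set
InIm+2K {r} M x = ∃ λ (z : ZVec r) → ∃ λ (t : ZVec r) →
  InK M t × (∀ u → x u ≡ applyL M z u ℤ.+ (+ 2) ℤ.* t u)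

_+ᶻ_ : ∀ {r} → ZVec r → ZVec r → ZVec r
(x +ᶻ y) u = x u ℤ.+ y u

-- K(G) ⊗ ℤ/2 = K(G)/2K(G) ≅ (ℤ/2)^k, witnessed by a map f defined on lifts,
-- additive on K, surjective from K, with kernel exactly 2K(G).
K⊗Z2≅ : ∀ {r n} → Vec (F2 r) n → ℕ → Set
K⊗Z2≅ {r} M k = ∃ λ (f : ZVec r → F2 k) →
    (∀ x y → InK M x → InK M y → f (x +ᶻ y) ≡ f x ⊕ f y)
  × (∀ b → ∃ λ x → InK M x × f x ≡ b)
  × (∀ x → InK M x → (f x ≡ 𝟎 → InIm+2K M x) × (InIm+2K M x → f x ≡ 𝟎))

module Submission where

-- The Laplacian acts on ℤ^(F₂^r) as convolution, in the group ring ℤ[F₂^r], with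
-- L = n·δ − Σᵢ δ_{vᵢ}. Its Hadamard transform at s is 2·#{i : s·vᵢ = 1}, which vanishes
-- only at s = 0 because M generates; so K(G) is the sum-zero part of ℤ^(F₂^r) modulo L,
-- and K(G)/2K(G) is the augmentation-zero part of 𝔽₂[F₂^r] modulo the ideal generated by
-- the reduction L̄. Pick a coordinate j at which Σᵢ vᵢ is 1 and split every y ∈ 𝔽₂[F₂^r]
-- as y₀ + y₁·e_j with y₀, y₁ ∈ 𝔽₂[F₂^(r-1)]. Then L̄ = α + β·e_j, where β has augmentation
-- Σᵢ (vᵢ)_j = 1, hence so does α as aug L̄ = 0. In characteristic 2, b² = aug(b)·δ, so
-- α² = β² = 1, and y ↦ y₀ + αβ·y₁ is an augmentation-preserving surjection onto
-- 𝔽₂[F₂^(r-1)] with kernel exactly L̄·𝔽₂[F₂^r]. The augmentation-zero part of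
-- 𝔽₂[F₂^(r-1)] has dimension 2^(r-1) − 1.

open import Defs
open import Algebra.Bundles using (AbelianGroup; CommutativeRing)
open import Algebra.Core using (Op₁; Op₂)
open import Algebra.Structures using (IsCommutativeRing)
import Algebra.Properties.AbelianGroup as AbelianGroupProperties
import Algebra.Properties.CommutativeSemigroup as CommutativeSemigroupProperties
open import Data.Bool using (Bool; true; false; _xor_; _∧_; not; if_then_else_)
open import Data.Bool.Properties
  using (xor-assoc; xor-comm; xor-same; xor-identityˡ; xor-identityʳ; true-xor; xor-annihilates-not;
         not-distribˡ-xor; not-involutive; ∧-comm; ∧-assoc; ∧-idem; ∧-identityʳ; ∧-zeroʳ; ∧-distribˡ-xor;
         xor-∧-commutativeRing; if-float)
open import Data.Empty using (⊥-elim)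
open import Data.Fin using (Fin; zero; suc)
open import Data.Integer as ℤ using (ℤ; +_; -[1+_]; 0ℤ; 1ℤ; -1ℤ; _⊖_; ∣_∣)
import Data.Integer.Properties as ℤP
open import Data.Integer.Tactic.RingSolver using (solve-∀)
open import Data.List using (List; []; _∷_; map) renaming (_++_ to _++ᴸ_)
open import Data.List.Properties using (map-++; map-∘)
open import Data.Nat as ℕ using (ℕ; zero; suc; _≤_; _^_; _∸_; _!; NonZero)
open import Data.Nat.Divisibility using (_∣_; divides; ∣-trans; m∣m*n; m≤n⇒m!∣n!)
import Data.Nat.Properties as ℕP
open import Data.Product using (∃; _×_; _,_; proj₁; proj₂)
open import Data.Vec using (Vec; []; _∷_; _++_; lookup; insertAt; removeAt; splitAt)
open import Data.Vec.Properties
  using (zipWith-assoc; zipWith-comm; zipWith-identityˡ; zipWith-identityʳ; zipWith-++; ++-injective;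
         lookup-replicate; lookup-zipWith; insertAt-lookup; removeAt-insertAt; insertAt-removeAt)
open import Function using (_∘_)
open import Relation.Binary.PropositionalEquality
open import Relation.Nullary using (does; yes; no; ¬_)

open CommutativeSemigroupProperties (CommutativeRing.+-commutativeSemigroup xor-∧-commutativeRing)
  using () renaming (interchange to xor-interchange)

xor≡false⇒≡ : ∀ a b → a xor b ≡ false → a ≡ b
xor≡false⇒≡ false false _ = refl
xor≡false⇒≡ true  true  _ = refl

⊕-assoc : ∀ {r} (u v w : F2 r) → (u ⊕ v) ⊕ w ≡ u ⊕ (v ⊕ w)
⊕-assoc = zipWith-assoc xor-assoc

⊕-comm : ∀ {r} (u v : F2 r) → u ⊕ v ≡ v ⊕ u
⊕-comm = zipWith-comm xor-comm

⊕-identityˡ : ∀ {r} (u : F2 r) → 𝟎 ⊕ u ≡ u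
⊕-identityˡ = zipWith-identityˡ xor-identityˡ

⊕-identityʳ : ∀ {r} (u : F2 r) → u ⊕ 𝟎 ≡ u
⊕-identityʳ = zipWith-identityʳ xor-identityʳ

⊕-self : ∀ {r} (u : F2 r) → u ⊕ u ≡ 𝟎
⊕-self []      = refl
⊕-self (a ∷ u) = cong₂ _∷_ (xor-same a) (⊕-self u)

⊕-cancelʳ : ∀ {r} (u v : F2 r) → (v ⊕ u) ⊕ u ≡ v
⊕-cancelʳ u v = begin
  (v ⊕ u) ⊕ u  ≡⟨ ⊕-assoc v u u ⟩
  v ⊕ (u ⊕ u)  ≡⟨ cong (v ⊕_) (⊕-self u) ⟩
  v ⊕ 𝟎        ≡⟨ ⊕-identityʳ v ⟩
  v            ∎
  where open ≡-Reasoning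

u⊕[v⊕u]≡v : ∀ {r} (u v : F2 r) → u ⊕ (v ⊕ u) ≡ v
u⊕[v⊕u]≡v u v = trans (⊕-comm u (v ⊕ u)) (⊕-cancelʳ u v)

isZero : ∀ {r} → F2 r → Bool
isZero []      = true
isZero (b ∷ u) = not b ∧ isZero u

isZero-𝟎 : ∀ r → isZero (𝟎 {r}) ≡ true
isZero-𝟎 zero    = refl
isZero-𝟎 (suc r) = isZero-𝟎 r

isZero⇒≡𝟎 : ∀ {r} (u : F2 r) → isZero u ≡ true → u ≡ 𝟎
isZero⇒≡𝟎 []          _ = refl
isZero⇒≡𝟎 (false ∷ u) h = cong (false ∷_) (isZero⇒≡𝟎 u h)

isZero-⊕⇒≡ : ∀ {r} (u v : F2 r) → isZero (u ⊕ v) ≡ true → u ≡ v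
isZero-⊕⇒≡ u v h = trans (sym (⊕-cancelʳ v u)) (trans (cong (_⊕ v) (isZero⇒≡𝟎 (u ⊕ v) h)) (⊕-identityˡ v))

does-≟V : ∀ {r} (u v : F2 r) → does (u ≟V v) ≡ isZero (u ⊕ v)
does-≟V {r} u v with u ≟V v | isZero (u ⊕ v) in eq
... | yes refl | b     = trans (sym (isZero-𝟎 r)) (trans (cong isZero (sym (⊕-self u))) eq)
... | no _     | false = refl
... | no u≢v   | true  = ⊥-elim (u≢v (isZero-⊕⇒≡ u v eq))

insertAt-⊕ : ∀ {s} (u v : F2 s) (j : Fin (suc s)) b c →
  insertAt u j b ⊕ insertAt v j c ≡ insertAt (u ⊕ v) j (b xor c)
insertAt-⊕ u       v       zero    b c = refl
insertAt-⊕ (a ∷ u) (d ∷ v) (suc j) b c = cong ((a xor d) ∷_) (insertAt-⊕ u v j b c)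

isZero-insertAt : ∀ {s} (u : F2 s) (j : Fin (suc s)) b → isZero (insertAt u j b) ≡ not b ∧ isZero u
isZero-insertAt u       zero    b = refl
isZero-insertAt (a ∷ u) (suc j) b = begin
  not a ∧ isZero (insertAt u j b)   ≡⟨ cong (not a ∧_) (isZero-insertAt u j b) ⟩
  not a ∧ (not b ∧ isZero u)        ≡⟨ ∧-assoc (not a) (not b) (isZero u) ⟨
  (not a ∧ not b) ∧ isZero u        ≡⟨ cong (_∧ isZero u) (∧-comm (not a) (not b)) ⟩
  (not b ∧ not a) ∧ isZero u        ≡⟨ ∧-assoc (not b) (not a) (isZero u) ⟩
  not b ∧ (not a ∧ isZero u)        ∎
  where open ≡-Reasoning

slice : ∀ {s} {A : Set} → Fin (suc s) → Bool → (F2 (suc s) → A) → F2 s → A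
slice j b f u = f (insertAt u j b)

glue : ∀ {s} {A : Set} → Fin (suc s) → (F2 s → A) → (F2 s → A) → F2 (suc s) → A
glue j g₀ g₁ w = if lookup w j then g₁ (removeAt w j) else g₀ (removeAt w j)

glue-insertAt : ∀ {s} {A : Set} (j : Fin (suc s)) (g₀ g₁ : F2 s → A) b u →
  slice j b (glue j g₀ g₁) u ≡ (if b then g₁ u else g₀ u)
glue-insertAt j g₀ g₁ b u
  rewrite insertAt-lookup u j b | removeAt-insertAt u j b = refl

slices-ext : ∀ {s} {A : Set} (j : Fin (suc s)) {f g : F2 (suc s) → A} →
  (∀ b u → slice j b f u ≡ slice j b g u) → ∀ w → f w ≡ g w
slices-ext j {f} {g} f≗g w = begin
  f w                                                ≡⟨ cong f (insertAt-removeAt w j) ⟨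
  f (insertAt (removeAt w j) j (lookup w j))         ≡⟨ f≗g (lookup w j) (removeAt w j) ⟩
  g (insertAt (removeAt w j) j (lookup w j))         ≡⟨ cong g (insertAt-removeAt w j) ⟩
  g w                                                ∎
  where open ≡-Reasoning

dot : ∀ {r} → F2 r → F2 r → Bool
dot []      []      = false
dot (a ∷ s) (b ∷ u) = (a ∧ b) xor dot s u

dot-comm : ∀ {r} (s u : F2 r) → dot s u ≡ dot u s
dot-comm []      []      = refl
dot-comm (a ∷ s) (b ∷ u) = cong₂ _xor_ (∧-comm a b) (dot-comm s u)

dot-⊕ʳ : ∀ {r} (s u v : F2 r) → dot s (u ⊕ v) ≡ dot s u xor dot s v
dot-⊕ʳ []      []      []      = refl
dot-⊕ʳ (a ∷ s) (b ∷ u) (c ∷ v) =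
  trans (cong₂ _xor_ (∧-distribˡ-xor a b c) (dot-⊕ʳ s u v))
        (xor-interchange (a ∧ b) (a ∧ c) (dot s u) (dot s v))

dot-𝟎ˡ : ∀ {r} (u : F2 r) → dot 𝟎 u ≡ false
dot-𝟎ˡ []      = refl
dot-𝟎ˡ (b ∷ u) = dot-𝟎ˡ u

nonzero⇒∃dot≡true : ∀ {r} (s : F2 r) → ¬ s ≡ 𝟎 → ∃ λ w → dot s w ≡ true
nonzero⇒∃dot≡true []          s≢𝟎 = ⊥-elim (s≢𝟎 refl)
nonzero⇒∃dot≡true (true ∷ s)  _   = (true ∷ 𝟎) , cong not (trans (dot-comm s 𝟎) (dot-𝟎ˡ s))
nonzero⇒∃dot≡true (false ∷ s) s≢𝟎 with nonzero⇒∃dot≡true s (s≢𝟎 ∘ cong (false ∷_))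
... | w , s·w≡1 = (false ∷ w) , s·w≡1

nonzero⇒∃lookup≡true : ∀ {k} (v : Vec Bool k) → ¬ v ≡ 𝟎 → ∃ λ j → lookup v j ≡ true
nonzero⇒∃lookup≡true []          v≢𝟎 = ⊥-elim (v≢𝟎 refl)
nonzero⇒∃lookup≡true (true ∷ v)  _   = zero , refl
nonzero⇒∃lookup≡true (false ∷ v) v≢𝟎 with nonzero⇒∃lookup≡true v (v≢𝟎 ∘ cong (false ∷_))
... | j , vⱼ≡1 = suc j , vⱼ≡1

-- The group rings ℤ[F₂^r] and 𝔽₂[F₂^r]

module GroupRing {A : Set} {_+_ _*_ : Op₂ A} { -_ : Op₁ A} {0# 1# : A}
  (isCommutativeRing : IsCommutativeRing _≡_ _+_ _*_ -_ 0# 1#) where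

  open IsCommutativeRing isCommutativeRing
    using (+-assoc; +-comm; +-identityˡ; +-identityʳ; distribˡ; distribʳ; zeroˡ; zeroʳ;
           *-comm; *-assoc; *-identityˡ; +-isAbelianGroup)

  private
    +-abelianGroup : AbelianGroup _ _
    +-abelianGroup = record { isAbelianGroup = +-isAbelianGroup }
    open AbelianGroupProperties +-abelianGroup using (⁻¹-∙-comm)
    open CommutativeSemigroupProperties (AbelianGroup.commutativeSemigroup +-abelianGroup)
      using (interchange)

  ∑ : ∀ r → (F2 r → A) → A
  ∑ zero    f = f []
  ∑ (suc r) f = ∑ r (f ∘ (false ∷_)) + ∑ r (f ∘ (true ∷_))

  ∑-cong : ∀ r {f g : F2 r → A} → (∀ u → f u ≡ g u) → ∑ r f ≡ ∑ r g
  ∑-cong zero    f≗g = f≗g []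
  ∑-cong (suc r) f≗g = cong₂ _+_ (∑-cong r (f≗g ∘ (false ∷_))) (∑-cong r (f≗g ∘ (true ∷_)))

  ∑-distrib-+ : ∀ r (f g : F2 r → A) → ∑ r (λ u → f u + g u) ≡ ∑ r f + ∑ r g
  ∑-distrib-+ zero    f g = refl
  ∑-distrib-+ (suc r) f g =
    trans (cong₂ _+_ (∑-distrib-+ r _ _) (∑-distrib-+ r _ _)) (interchange _ _ _ _)

  ∑-zero : ∀ r → ∑ r (λ _ → 0#) ≡ 0#
  ∑-zero zero    = refl
  ∑-zero (suc r) = trans (cong₂ _+_ (∑-zero r) (∑-zero r)) (+-identityˡ 0#)

  ∑-neg : ∀ r (f : F2 r → A) → ∑ r (λ u → - f u) ≡ - ∑ r f
  ∑-neg zero    f = refl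
  ∑-neg (suc r) f = trans (cong₂ _+_ (∑-neg r _) (∑-neg r _)) (⁻¹-∙-comm _ _)

  ∑-*ˡ : ∀ r (c : A) (f : F2 r → A) → ∑ r (λ u → c * f u) ≡ c * ∑ r f
  ∑-*ˡ zero    c f = refl
  ∑-*ˡ (suc r) c f = trans (cong₂ _+_ (∑-*ˡ r c _) (∑-*ˡ r c _)) (sym (distribˡ c _ _))

  ∑-*ʳ : ∀ r (c : A) (f : F2 r → A) → ∑ r (λ u → f u * c) ≡ ∑ r f * c
  ∑-*ʳ r c f = trans (∑-cong r (λ u → *-comm (f u) c)) (trans (∑-*ˡ r c f) (*-comm c _))

  ∑-translate : ∀ r (f : F2 r → A) (c : F2 r) → ∑ r (λ u → f (u ⊕ c)) ≡ ∑ r f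
  ∑-translate zero    f []          = refl
  ∑-translate (suc r) f (false ∷ c) =
    cong₂ _+_ (∑-translate r (f ∘ (false ∷_)) c) (∑-translate r (f ∘ (true ∷_)) c)
  ∑-translate (suc r) f (true ∷ c)  = trans (+-comm _ _)
    (cong₂ _+_ (∑-translate r (f ∘ (false ∷_)) c) (∑-translate r (f ∘ (true ∷_)) c))

  ∑-comm : ∀ r q (f : F2 r → F2 q → A) → ∑ r (λ u → ∑ q (f u)) ≡ ∑ q (λ v → ∑ r (λ u → f u v))
  ∑-comm zero    q f = refl
  ∑-comm (suc r) q f = trans (cong₂ _+_ (∑-comm r q _) (∑-comm r q _)) (sym (∑-distrib-+ q _ _))

  ∑-slices : ∀ s (j : Fin (suc s)) (f : F2 (suc s) → A) →
    ∑ (suc s) f ≡ ∑ s (slice j false f) + ∑ s (slice j true f)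
  ∑-slices s       zero    f = refl
  ∑-slices (suc s) (suc j) f = trans
    (cong₂ _+_ (∑-slices s j (f ∘ (false ∷_))) (∑-slices s j (f ∘ (true ∷_))))
    (interchange _ _ _ _)

  δ : ∀ {r} → F2 r → A
  δ w = if isZero w then 1# else 0#

  ∑-δ*₀ : ∀ r (h : F2 r → A) → ∑ r (λ w → δ w * h w) ≡ h 𝟎
  ∑-δ*₀ zero    h = *-identityˡ (h [])
  ∑-δ*₀ (suc r) h = begin
    ∑ r (λ w → δ w * h (false ∷ w)) + ∑ r (λ w → 0# * h (true ∷ w))
      ≡⟨ cong₂ _+_ (∑-δ*₀ r (h ∘ (false ∷_))) (trans (∑-cong r (zeroˡ ∘ h ∘ (true ∷_))) (∑-zero r)) ⟩
    h 𝟎 + 0#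
      ≡⟨ +-identityʳ (h 𝟎) ⟩
    h 𝟎 ∎
    where open ≡-Reasoning

  ∑-δ* : ∀ r (c : F2 r) (h : F2 r → A) → ∑ r (λ w → δ (c ⊕ w) * h w) ≡ h c
  ∑-δ* r c h = begin
    ∑ r (λ w → δ (c ⊕ w) * h w)
      ≡⟨ ∑-translate r _ c ⟨
    ∑ r (λ w → δ (c ⊕ (w ⊕ c)) * h (w ⊕ c))
      ≡⟨ ∑-cong r (λ w → cong (λ x → δ x * h (w ⊕ c)) (u⊕[v⊕u]≡v c w)) ⟩
    ∑ r (λ w → δ w * h (w ⊕ c))
      ≡⟨ ∑-δ*₀ r (λ w → h (w ⊕ c)) ⟩
    h (𝟎 ⊕ c)
      ≡⟨ cong h (⊕-identityˡ c) ⟩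
    h c ∎
    where open ≡-Reasoning

  infixl 7 _⋆_
  _⋆_ : ∀ {r} → (F2 r → A) → (F2 r → A) → F2 r → A
  (a ⋆ b) u = ∑ _ (λ v → a (u ⊕ v) * b v)

  ⋆-cong : ∀ {r} {a a′ b b′ : F2 r → A} → (∀ u → a u ≡ a′ u) → (∀ u → b u ≡ b′ u) →
    ∀ u → (a ⋆ b) u ≡ (a′ ⋆ b′) u
  ⋆-cong {r} a≗a′ b≗b′ u = ∑-cong r (λ v → cong₂ _*_ (a≗a′ _) (b≗b′ v))

  ⋆-congʳ : ∀ {r} (a : F2 r → A) {b b′ : F2 r → A} → (∀ u → b u ≡ b′ u) →
    ∀ u → (a ⋆ b) u ≡ (a ⋆ b′) u
  ⋆-congʳ a = ⋆-cong {a = a} (λ _ → refl)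

  ⋆-comm : ∀ {r} (a b : F2 r → A) u → (a ⋆ b) u ≡ (b ⋆ a) u
  ⋆-comm {r} a b u = trans (sym (∑-translate r _ u)) (∑-cong r (λ v → trans
    (cong₂ _*_ (cong a (u⊕[v⊕u]≡v u v)) (cong b (⊕-comm v u)))
    (*-comm (a v) (b (u ⊕ v)))))

  ⋆-assoc : ∀ {r} (a b c : F2 r → A) u → ((a ⋆ b) ⋆ c) u ≡ (a ⋆ (b ⋆ c)) u
  ⋆-assoc {r} a b c u = begin
    ∑ r (λ v → ∑ r (λ w → a ((u ⊕ v) ⊕ w) * b w) * c v)
      ≡⟨ ∑-cong r (λ v → trans (sym (∑-*ʳ r (c v) _)) (sym (∑-translate r _ v))) ⟩
    ∑ r (λ v → ∑ r (λ w → (a ((u ⊕ v) ⊕ (w ⊕ v)) * b (w ⊕ v)) * c v))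
      ≡⟨ ∑-cong r (λ v → ∑-cong r (λ w →
           trans (*-assoc _ (b (w ⊕ v)) (c v)) (cong (λ x → a x * (b (w ⊕ v) * c v)) (shift v w)))) ⟩
    ∑ r (λ v → ∑ r (λ w → a (u ⊕ w) * (b (w ⊕ v) * c v)))
      ≡⟨ ∑-comm r r _ ⟨
    ∑ r (λ w → ∑ r (λ v → a (u ⊕ w) * (b (w ⊕ v) * c v)))
      ≡⟨ ∑-cong r (λ w → ∑-*ˡ r (a (u ⊕ w)) _) ⟩
    ∑ r (λ w → a (u ⊕ w) * (b ⋆ c) w) ∎
    where
    open ≡-Reasoning
    shift : ∀ v w → (u ⊕ v) ⊕ (w ⊕ v) ≡ u ⊕ w
    shift v w = trans (⊕-assoc u v (w ⊕ v)) (cong (u ⊕_) (u⊕[v⊕u]≡v v w))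

  ⋆-distribˡ : ∀ {r} (a b c : F2 r → A) u → (a ⋆ (λ v → b v + c v)) u ≡ (a ⋆ b) u + (a ⋆ c) u
  ⋆-distribˡ {r} a b c u = trans (∑-cong r (λ v → distribˡ (a (u ⊕ v)) (b v) (c v))) (∑-distrib-+ r _ _)

  ⋆-zeroʳ : ∀ {r} (a : F2 r → A) u → (a ⋆ (λ _ → 0#)) u ≡ 0#
  ⋆-zeroʳ {r} a u = trans (∑-cong r (λ v → zeroʳ (a (u ⊕ v)))) (∑-zero r)

  ⋆-*ʳ : ∀ {r} (a b : F2 r → A) c u → (a ⋆ (λ v → c * b v)) u ≡ c * (a ⋆ b) u
  ⋆-*ʳ {r} a b c u = trans (∑-cong r (λ v → swap (a (u ⊕ v)) c (b v))) (∑-*ˡ r c _)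
    where
    swap : ∀ x c y → x * (c * y) ≡ c * (x * y)
    swap x c y = trans (sym (*-assoc x c y)) (trans (cong (_* y) (*-comm x c)) (*-assoc c x y))

  δ-⋆ : ∀ {r} (a : F2 r → A) u → (δ ⋆ a) u ≡ a u
  δ-⋆ {r} a u = ∑-δ* r u a

  ∑-⋆ : ∀ r (a b : F2 r → A) → ∑ r (a ⋆ b) ≡ ∑ r a * ∑ r b
  ∑-⋆ r a b = begin
    ∑ r (λ u → ∑ r (λ v → a (u ⊕ v) * b v))  ≡⟨ ∑-comm r r _ ⟩
    ∑ r (λ v → ∑ r (λ u → a (u ⊕ v) * b v))  ≡⟨ ∑-cong r (λ v → ∑-*ʳ r (b v) _) ⟩
    ∑ r (λ v → ∑ r (λ u → a (u ⊕ v)) * b v)  ≡⟨ ∑-cong r (λ v → cong (_* b v) (∑-translate r a v)) ⟩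
    ∑ r (λ v → ∑ r a * b v)                  ≡⟨ ∑-*ˡ r (∑ r a) b ⟩
    ∑ r a * ∑ r b                            ∎
    where open ≡-Reasoning

  ⋆-slice : ∀ {s} (j : Fin (suc s)) (a z : F2 (suc s) → A) b u →
    slice j b (a ⋆ z) u ≡ (slice j b a ⋆ slice j false z) u + (slice j (not b) a ⋆ slice j true z) u
  ⋆-slice {s} j a z b u = trans (∑-slices s j (λ w → a (insertAt u j b ⊕ w) * z w)) (cong₂ _+_
    (∑-cong s (λ v → cong (λ w → a w * z (insertAt v j false))
      (trans (insertAt-⊕ u v j b false) (cong (insertAt (u ⊕ v) j) (xor-identityʳ b)))))
    (∑-cong s (λ v → cong (λ w → a w * z (insertAt v j true))
      (trans (insertAt-⊕ u v j b true)
             (cong (insertAt (u ⊕ v) j) (trans (xor-comm b true) (true-xor b)))))))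

  occurrences : ∀ {r k} → Vec (F2 r) k → F2 r → A
  occurrences []      w = 0#
  occurrences (m ∷ N) w = δ (m ⊕ w) + occurrences N w

  sumOver : ∀ {r k} → (F2 r → A) → Vec (F2 r) k → A
  sumOver g []      = 0#
  sumOver g (m ∷ N) = g m + sumOver g N

  ∑-occurrences* : ∀ r {k} (N : Vec (F2 r) k) (g : F2 r → A) →
    ∑ r (λ w → occurrences N w * g w) ≡ sumOver g N
  ∑-occurrences* r []      g = trans (∑-cong r (zeroˡ ∘ g)) (∑-zero r)
  ∑-occurrences* r (m ∷ N) g = trans (∑-cong r (λ w → distribʳ (g w) _ _))
    (trans (∑-distrib-+ r _ _) (cong₂ _+_ (∑-δ* r m g) (∑-occurrences* r N g)))

  δ-nonzero : ∀ {r} {w : F2 r} → ¬ w ≡ 𝟎 → δ w ≡ 0#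
  δ-nonzero {w = w} w≢𝟎 with isZero w in eq
  ... | true  = ⊥-elim (w≢𝟎 (isZero⇒≡𝟎 w eq))
  ... | false = refl

module ℤ[G] = GroupRing ℤP.+-*-isCommutativeRing
module 𝔽₂[G] = GroupRing (CommutativeRing.isCommutativeRing xor-∧-commutativeRing)

lookup-sumList : ∀ {s k} (N : Vec (F2 s) k) (j : Fin s) →
  lookup (sumList N) j ≡ 𝔽₂[G].sumOver (λ w → lookup w j) N
lookup-sumList []      j = lookup-replicate j false
lookup-sumList (m ∷ N) j =
  trans (lookup-zipWith _xor_ j m (sumList N)) (cong (lookup m j xor_) (lookup-sumList N j))

∑-slice-true : ∀ s (j : Fin (suc s)) (f : F2 (suc s) → Bool) →
  𝔽₂[G].∑ s (slice j true f) ≡ 𝔽₂[G].∑ (suc s) (λ w → f w ∧ lookup w j)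
∑-slice-true s j f = sym (trans (𝔽₂[G].∑-slices s j (λ w → f w ∧ lookup w j)) (cong₂ _xor_
  (trans (𝔽₂[G].∑-cong s (λ u → trans (at u false) (∧-zeroʳ _))) (𝔽₂[G].∑-zero s))
  (𝔽₂[G].∑-cong s (λ u → trans (at u true) (∧-identityʳ _)))))
  where
  at : ∀ u b → f (insertAt u j b) ∧ lookup (insertAt u j b) j ≡ f (insertAt u j b) ∧ b
  at u b = cong (f (insertAt u j b) ∧_) (insertAt-lookup u j b)

∑-glue : ∀ s (j : Fin (suc s)) (p q : F2 s → Bool) →
  𝔽₂[G].∑ (suc s) (glue j p q) ≡ 𝔽₂[G].∑ s p xor 𝔽₂[G].∑ s q
∑-glue s j p q = trans (𝔽₂[G].∑-slices s j (glue j p q))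
  (cong₂ _xor_ (𝔽₂[G].∑-cong s (glue-insertAt j p q false)) (𝔽₂[G].∑-cong s (glue-insertAt j p q true)))

-- Squares in characteristic two

module 𝔽₂[G]-Properties where
  open 𝔽₂[G]

  ∑-symmetric-off-diagonal : ∀ r (h : F2 r → F2 r → Bool) → (∀ x y → h x y ≡ h y x) →
    ∀ u → ¬ u ≡ 𝟎 → ∑ r (λ v → h (u ⊕ v) v) ≡ false
  ∑-symmetric-off-diagonal zero    h h-sym []          u≢𝟎 = ⊥-elim (u≢𝟎 refl)
  ∑-symmetric-off-diagonal (suc r) h h-sym (false ∷ u) u≢𝟎 = cong₂ _xor_ (within false) (within true)
    where
    within : ∀ b → ∑ r (λ v → h (b ∷ (u ⊕ v)) (b ∷ v)) ≡ false
    within b = ∑-symmetric-off-diagonal r (λ x y → h (b ∷ x) (b ∷ y)) (λ x y → h-sym _ _) u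
                 (u≢𝟎 ∘ cong (false ∷_))
  ∑-symmetric-off-diagonal (suc r) h h-sym (true ∷ u)  _   = trans (cong (half xor_) mirror) (xor-same half)
    where
    half : Bool
    half = ∑ r (λ v → h (true ∷ (u ⊕ v)) (false ∷ v))
    -- the involution v ↦ u ⊕ v exchanges the two halves of the sum
    mirror : ∑ r (λ v → h (false ∷ (u ⊕ v)) (true ∷ v)) ≡ half
    mirror = trans (∑-cong r (λ v → trans (h-sym _ _) (cong₂ (λ x y → h (true ∷ x) (false ∷ y))
        (sym (u⊕[v⊕u]≡v u v)) (⊕-comm u v))))
      (∑-translate r (λ w → h (true ∷ (u ⊕ w)) (false ∷ w)) u)

  ⋆-self : ∀ {r} (b : F2 r → Bool) u → (b ⋆ b) u ≡ δ u ∧ ∑ r b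
  ⋆-self {r} b u with u ≟V 𝟎
  ... | yes refl rewrite isZero-𝟎 r =
    ∑-cong r (λ v → trans (cong (λ w → b w ∧ b v) (⊕-identityˡ v)) (∧-idem (b v)))
  ... | no u≢𝟎 rewrite δ-nonzero u≢𝟎 =
    ∑-symmetric-off-diagonal r (λ x y → b x ∧ b y) (λ x y → ∧-comm (b x) (b y)) u u≢𝟎

  ⋆-involutive : ∀ {r} (b : F2 r → Bool) → ∑ r b ≡ true → ∀ z u → (b ⋆ (b ⋆ z)) u ≡ z u
  ⋆-involutive {r} b ∑b≡1 z u = begin
    (b ⋆ (b ⋆ z)) u  ≡⟨ ⋆-assoc b b z u ⟨
    ((b ⋆ b) ⋆ z) u  ≡⟨ ⋆-cong {b = z} b⋆b≡δ (λ _ → refl) u ⟩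
    (δ ⋆ z) u        ≡⟨ δ-⋆ z u ⟩
    z u              ∎
    where
    open ≡-Reasoning
    b⋆b≡δ : ∀ w → (b ⋆ b) w ≡ δ w
    b⋆b≡δ w = trans (⋆-self b w) (trans (cong (δ w ∧_) ∑b≡1) (∧-identityʳ (δ w)))

module Splitting {s : ℕ} (j : Fin (suc s)) (a : F2 (suc s) → Bool)
  (∑α≡1 : 𝔽₂[G].∑ s (slice j false a) ≡ true) (∑β≡1 : 𝔽₂[G].∑ s (slice j true a) ≡ true) where
  open 𝔽₂[G]
  open 𝔽₂[G]-Properties

  α β : F2 s → Bool
  α = slice j false a
  β = slice j true a

  αβ⋆ : (F2 s → Bool) → F2 s → Bool
  αβ⋆ y = α ⋆ (β ⋆ y)

  αβ⋆-cong : ∀ {y y′} → (∀ u → y u ≡ y′ u) → ∀ u → αβ⋆ y u ≡ αβ⋆ y′ u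
  αβ⋆-cong y≗y′ = ⋆-congʳ α (⋆-congʳ β y≗y′)

  αβ⋆-xor : ∀ y y′ u → αβ⋆ (λ v → y v xor y′ v) u ≡ αβ⋆ y u xor αβ⋆ y′ u
  αβ⋆-xor y y′ u = trans (⋆-congʳ α (⋆-distribˡ β y y′) u) (⋆-distribˡ α (β ⋆ y) (β ⋆ y′) u)

  αβα⋆ : ∀ z u → αβ⋆ (α ⋆ z) u ≡ (β ⋆ z) u
  αβα⋆ z u = begin
    (α ⋆ (β ⋆ (α ⋆ z))) u  ≡⟨ ⋆-congʳ α (λ w → ⋆-assoc β α z w) u ⟨
    (α ⋆ ((β ⋆ α) ⋆ z)) u  ≡⟨ ⋆-congʳ α (⋆-cong {b = z} (⋆-comm β α) (λ _ → refl)) u ⟩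
    (α ⋆ ((α ⋆ β) ⋆ z)) u  ≡⟨ ⋆-congʳ α (⋆-assoc α β z) u ⟩
    (α ⋆ (α ⋆ (β ⋆ z))) u  ≡⟨ ⋆-involutive α ∑α≡1 (β ⋆ z) u ⟩
    (β ⋆ z) u              ∎
    where open ≡-Reasoning

  Φ : (F2 (suc s) → Bool) → F2 s → Bool
  Φ y u = slice j false y u xor αβ⋆ (slice j true y) u

  Φ-cong : ∀ {y y′} → (∀ w → y w ≡ y′ w) → ∀ u → Φ y u ≡ Φ y′ u
  Φ-cong y≗y′ u = cong₂ _xor_ (y≗y′ _) (αβ⋆-cong (λ v → y≗y′ (insertAt v j true)) u)

  Φ-xor : ∀ y y′ u → Φ (λ w → y w xor y′ w) u ≡ Φ y u xor Φ y′ u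
  Φ-xor y y′ u = trans (cong (slice j false (λ w → y w xor y′ w) u xor_) (αβ⋆-xor _ _ u))
    (xor-interchange (y (insertAt u j false)) (y′ (insertAt u j false)) _ _)

  ∑-Φ : ∀ y → ∑ s (Φ y) ≡ ∑ (suc s) y
  ∑-Φ y = begin
    ∑ s (Φ y)
      ≡⟨ ∑-distrib-+ s _ _ ⟩
    ∑ s (slice j false y) xor ∑ s (α ⋆ (β ⋆ slice j true y))
      ≡⟨ cong (∑ s (slice j false y) xor_) (trans (∑-⋆ s α _) (cong₂ _∧_ ∑α≡1 (∑-⋆ s β _))) ⟩
    ∑ s (slice j false y) xor (true ∧ (∑ s β ∧ ∑ s (slice j true y)))
      ≡⟨ cong (λ b → ∑ s (slice j false y) xor (b ∧ ∑ s (slice j true y))) ∑β≡1 ⟩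
    ∑ s (slice j false y) xor ∑ s (slice j true y)
      ≡⟨ ∑-slices s j y ⟨
    ∑ (suc s) y ∎
    where open ≡-Reasoning

  Φ-annihilates : ∀ z u → Φ (a ⋆ z) u ≡ false
  Φ-annihilates z u = begin
    slice j false (a ⋆ z) u xor αβ⋆ (slice j true (a ⋆ z)) u
      ≡⟨ cong₂ _xor_ (⋆-slice j a z false u) (αβ⋆-cong (⋆-slice j a z true) u) ⟩
    ((α ⋆ z₀) u xor (β ⋆ z₁) u) xor αβ⋆ (λ v → (β ⋆ z₀) v xor (α ⋆ z₁) v) u
      ≡⟨ cong (((α ⋆ z₀) u xor (β ⋆ z₁) u) xor_) (αβ⋆-xor (β ⋆ z₀) (α ⋆ z₁) u) ⟩
    ((α ⋆ z₀) u xor (β ⋆ z₁) u) xor (αβ⋆ (β ⋆ z₀) u xor αβ⋆ (α ⋆ z₁) u)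
      ≡⟨ cong (((α ⋆ z₀) u xor (β ⋆ z₁) u) xor_)
           (cong₂ _xor_ (⋆-congʳ α (⋆-involutive β ∑β≡1 z₀) u) (αβα⋆ z₁ u)) ⟩
    ((α ⋆ z₀) u xor (β ⋆ z₁) u) xor ((α ⋆ z₀) u xor (β ⋆ z₁) u)
      ≡⟨ xor-same ((α ⋆ z₀) u xor (β ⋆ z₁) u) ⟩
    false ∎
    where
    open ≡-Reasoning
    z₀ z₁ : F2 s → Bool
    z₀ = slice j false z
    z₁ = slice j true z

  Φ-glue : ∀ p u → Φ (glue j p (λ _ → false)) u ≡ p u
  Φ-glue p u = begin
    slice j false (glue j p (λ _ → false)) u xor αβ⋆ (slice j true (glue j p (λ _ → false))) u
      ≡⟨ cong₂ _xor_ (glue-insertAt j p _ false u) (αβ⋆-cong (glue-insertAt j p _ true) u) ⟩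
    p u xor αβ⋆ (λ _ → false) u
      ≡⟨ cong (p u xor_) (trans (⋆-congʳ α (⋆-zeroʳ β) u) (⋆-zeroʳ α u)) ⟩
    p u xor false
      ≡⟨ xor-identityʳ (p u) ⟩
    p u ∎
    where open ≡-Reasoning

  Φ≡0⇒∈a⋆ : ∀ y → (∀ u → Φ y u ≡ false) → ∃ λ q → ∀ w → (a ⋆ q) w ≡ y w
  Φ≡0⇒∈a⋆ y Φy≡0 = q , slices-ext j slices-agree
    where
    q : F2 (suc s) → Bool
    q = glue j (β ⋆ slice j true y) (λ _ → false)
    q₀ : ∀ v → slice j false q v ≡ (β ⋆ slice j true y) v
    q₀ = glue-insertAt j (β ⋆ slice j true y) _ false
    q₁ : ∀ v → slice j true q v ≡ false
    q₁ = glue-insertAt j (β ⋆ slice j true y) _ true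
    slices-agree : ∀ b u → slice j b (a ⋆ q) u ≡ slice j b y u
    slices-agree false u = begin
      slice j false (a ⋆ q) u
        ≡⟨ ⋆-slice j a q false u ⟩
      (α ⋆ slice j false q) u xor (β ⋆ slice j true q) u
        ≡⟨ cong₂ _xor_ (⋆-congʳ α q₀ u) (trans (⋆-congʳ β q₁ u) (⋆-zeroʳ β u)) ⟩
      αβ⋆ (slice j true y) u xor false
        ≡⟨ xor-identityʳ _ ⟩
      αβ⋆ (slice j true y) u
        ≡⟨ xor≡false⇒≡ _ _ (Φy≡0 u) ⟨
      slice j false y u ∎
      where open ≡-Reasoning
    slices-agree true u = begin
      slice j true (a ⋆ q) u
        ≡⟨ ⋆-slice j a q true u ⟩
      (β ⋆ slice j false q) u xor (α ⋆ slice j true q) u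
        ≡⟨ cong₂ _xor_ (trans (⋆-congʳ β q₀ u) (⋆-involutive β ∑β≡1 _ u))
                       (trans (⋆-congʳ α q₁ u) (⋆-zeroʳ α u)) ⟩
      slice j true y u xor false
        ≡⟨ xor-identityʳ _ ⟩
      slice j true y u ∎
      where open ≡-Reasoning

-- Functions F₂^s → 𝔽₂ of even weight

truthTable : ∀ {s} → (F2 s → Bool) → Vec Bool (2 ^ s)
truthTable {zero}  p = p [] ∷ []
truthTable {suc s} p = truthTable (p ∘ (false ∷_)) ++ (truthTable (p ∘ (true ∷_)) ++ [])

truthTable-cong : ∀ {s} {p q : F2 s → Bool} → (∀ u → p u ≡ q u) → truthTable p ≡ truthTable q
truthTable-cong {zero}  p≗q = cong (_∷ []) (p≗q [])
truthTable-cong {suc s} p≗q = cong₂ (λ x y → x ++ (y ++ []))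
  (truthTable-cong (p≗q ∘ (false ∷_))) (truthTable-cong (p≗q ∘ (true ∷_)))

truthTable-xor : ∀ {s} (p q : F2 s → Bool) → truthTable (λ u → p u xor q u) ≡ truthTable p ⊕ truthTable q
truthTable-xor {zero}  p q = refl
truthTable-xor {suc s} p q = begin
  truthTable (λ u → p (false ∷ u) xor q (false ∷ u))
    ++ (truthTable (λ u → p (true ∷ u) xor q (true ∷ u)) ++ [])
    ≡⟨ cong₂ (λ x y → x ++ (y ++ [])) (truthTable-xor (p ∘ (false ∷_)) (q ∘ (false ∷_)))
                                      (truthTable-xor (p ∘ (true ∷_)) (q ∘ (true ∷_))) ⟩
  (p₀ ⊕ q₀) ++ ((p₁ ⊕ q₁) ++ [])
    ≡⟨ cong ((p₀ ⊕ q₀) ++_) (zipWith-++ _xor_ p₁ [] q₁ []) ⟨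
  (p₀ ⊕ q₀) ++ ((p₁ ++ []) ⊕ (q₁ ++ []))
    ≡⟨ zipWith-++ _xor_ p₀ (p₁ ++ []) q₀ (q₁ ++ []) ⟨
  truthTable p ⊕ truthTable q ∎
  where
  open ≡-Reasoning
  p₀ p₁ q₀ q₁ : Vec Bool (2 ^ s)
  p₀ = truthTable (p ∘ (false ∷_))
  p₁ = truthTable (p ∘ (true ∷_))
  q₀ = truthTable (q ∘ (false ∷_))
  q₁ = truthTable (q ∘ (true ∷_))

𝟎-++ : ∀ m n → 𝟎 {m ℕ.+ n} ≡ 𝟎 {m} ++ 𝟎 {n}
𝟎-++ zero    n = refl
𝟎-++ (suc m) n = cong (false ∷_) (𝟎-++ m n)

𝟎-double : ∀ s → 𝟎 {2 ^ suc s} ≡ 𝟎 {2 ^ s} ++ (𝟎 {2 ^ s} ++ [])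
𝟎-double s = trans (𝟎-++ (2 ^ s) (2 ^ s ℕ.+ 0)) (cong (𝟎 {2 ^ s} ++_) (𝟎-++ (2 ^ s) 0))

truthTable-false : ∀ s → truthTable {s} (λ _ → false) ≡ 𝟎
truthTable-false zero    = refl
truthTable-false (suc s) =
  trans (cong₂ (λ x y → x ++ (y ++ [])) (truthTable-false s) (truthTable-false s)) (sym (𝟎-double s))

truthTable≡𝟎 : ∀ {s} (p : F2 s → Bool) → truthTable p ≡ 𝟎 → ∀ u → p u ≡ false
truthTable≡𝟎 {zero}  p table≡𝟎 [] = cong (λ { (x ∷ _) → x }) table≡𝟎
truthTable≡𝟎 {suc s} p table≡𝟎 (b ∷ u)
  with ++-injective (truthTable (p ∘ (false ∷_))) 𝟎 (trans table≡𝟎 (𝟎-double s))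
... | table₀≡𝟎 , rest≡𝟎 with b
...   | false = truthTable≡𝟎 (p ∘ (false ∷_)) table₀≡𝟎 u
...   | true  = truthTable≡𝟎 (p ∘ (true ∷_)) (proj₁ (++-injective (truthTable (p ∘ (true ∷_))) 𝟎 rest≡𝟎)) u

truthTable-surjective : ∀ {s} (v : Vec Bool (2 ^ s)) → ∃ λ (p : F2 s → Bool) → truthTable p ≡ v
truthTable-surjective {zero}  (x ∷ []) = (λ _ → x) , refl
truthTable-surjective {suc s} v with splitAt (2 ^ s) v
... | v₀ , v₁[] , refl with splitAt (2 ^ s) v₁[]
... | v₁ , [] , refl with truthTable-surjective {s} v₀ | truthTable-surjective {s} v₁
... | p₀ , table₀ | p₁ , table₁ =
  (λ { (false ∷ u) → p₀ u ; (true ∷ u) → p₁ u }) , cong₂ (λ x y → x ++ (y ++ [])) table₀ table₁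

xorAll : ∀ {m} → Vec Bool m → Bool
xorAll []       = false
xorAll (x ∷ xs) = x xor xorAll xs

xorAll-++ : ∀ {m n} (xs : Vec Bool m) (ys : Vec Bool n) → xorAll (xs ++ ys) ≡ xorAll xs xor xorAll ys
xorAll-++ []       ys = refl
xorAll-++ (x ∷ xs) ys = trans (cong (x xor_) (xorAll-++ xs ys)) (sym (xor-assoc x _ _))

xorAll-truthTable : ∀ {s} (p : F2 s → Bool) → xorAll (truthTable p) ≡ 𝔽₂[G].∑ s p
xorAll-truthTable {zero}  p = xor-identityʳ (p [])
xorAll-truthTable {suc s} p = trans (xorAll-++ (truthTable (p ∘ (false ∷_))) _)
  (cong₂ _xor_ (xorAll-truthTable (p ∘ (false ∷_)))
    (trans (xorAll-++ (truthTable (p ∘ (true ∷_))) [])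
           (trans (xor-identityʳ _) (xorAll-truthTable (p ∘ (true ∷_))))))

dropHead : ∀ {A : Set} {m} → Vec A m → Vec A (m ∸ 1)
dropHead []       = []
dropHead (x ∷ xs) = xs

dropHead-⊕ : ∀ {m} (u v : Vec Bool m) → dropHead (u ⊕ v) ≡ dropHead u ⊕ dropHead v
dropHead-⊕ []      []      = refl
dropHead-⊕ (a ∷ u) (b ∷ v) = refl

dropHead-𝟎 : ∀ m → dropHead (𝟎 {m}) ≡ 𝟎
dropHead-𝟎 zero    = refl
dropHead-𝟎 (suc m) = refl

dropHead≡𝟎 : ∀ {m} (v : Vec Bool m) → xorAll v ≡ false → dropHead v ≡ 𝟎 → v ≡ 𝟎
dropHead≡𝟎 []      _ _ = refl
dropHead≡𝟎 {suc m} (x ∷ v) even refl =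
  cong (_∷ 𝟎) (trans (sym (xor-identityʳ x)) (trans (cong (x xor_) (sym (xorAll-𝟎 m))) even))
  where
  xorAll-𝟎 : ∀ k → xorAll (𝟎 {k}) ≡ false
  xorAll-𝟎 zero    = refl
  xorAll-𝟎 (suc k) = xorAll-𝟎 k

dropHead-surjective : ∀ m .{{_ : NonZero m}} (b : Vec Bool (m ∸ 1)) →
  ∃ λ (v : Vec Bool m) → xorAll v ≡ false × dropHead v ≡ b
dropHead-surjective (suc m) b = (xorAll b ∷ b) , xor-same (xorAll b) , refl

-- forgets the value at 𝟎, which the other values determine when the weight is even
encode : ∀ {s} → (F2 s → Bool) → F2 (2 ^ s ∸ 1)
encode p = dropHead (truthTable p)

encode-cong : ∀ {s} {p q : F2 s → Bool} → (∀ u → p u ≡ q u) → encode p ≡ encode q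
encode-cong p≗q = cong dropHead (truthTable-cong p≗q)

encode-xor : ∀ {s} (p q : F2 s → Bool) → encode (λ u → p u xor q u) ≡ encode p ⊕ encode q
encode-xor p q = trans (cong dropHead (truthTable-xor p q)) (dropHead-⊕ (truthTable p) (truthTable q))

encode-false : ∀ s {p : F2 s → Bool} → (∀ u → p u ≡ false) → encode p ≡ 𝟎
encode-false s p≡0 =
  trans (encode-cong p≡0) (trans (cong dropHead (truthTable-false s)) (dropHead-𝟎 (2 ^ s)))

encode≡𝟎 : ∀ {s} (p : F2 s → Bool) → 𝔽₂[G].∑ s p ≡ false → encode p ≡ 𝟎 → ∀ u → p u ≡ false
encode≡𝟎 p ∑p≡0 encode≡𝟎 =
  truthTable≡𝟎 p (dropHead≡𝟎 (truthTable p) (trans (xorAll-truthTable p) ∑p≡0) encode≡𝟎)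

encode-surjective : ∀ s (b : F2 (2 ^ s ∸ 1)) → ∃ λ (p : F2 s → Bool) → 𝔽₂[G].∑ s p ≡ false × encode p ≡ b
encode-surjective s b with dropHead-surjective (2 ^ s) {{ℕP.m^n≢0 2 s}} b
... | v , even , tail≡b with truthTable-surjective {s} v
... | p , table≡v = p , trans (sym (xorAll-truthTable p)) (trans (cong xorAll table≡v) even) ,
                     trans (cong dropHead table≡v) tail≡b

isOdd : ℕ → Bool
isOdd zero    = false
isOdd (suc n) = not (isOdd n)

isOdd-+ : ∀ m n → isOdd (m ℕ.+ n) ≡ isOdd m xor isOdd n
isOdd-+ zero    n = refl
isOdd-+ (suc m) n = trans (cong not (isOdd-+ m n)) (not-distribˡ-xor (isOdd m) (isOdd n))

isOdd-* : ∀ m n → isOdd (m ℕ.* n) ≡ isOdd m ∧ isOdd n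
isOdd-* zero    n = refl
isOdd-* (suc m) n =
  trans (isOdd-+ n (m ℕ.* n)) (trans (cong (isOdd n xor_) (isOdd-* m n)) (absorb (isOdd m) (isOdd n)))
  where
  absorb : ∀ a b → b xor (a ∧ b) ≡ not a ∧ b
  absorb false b = xor-identityʳ b
  absorb true  b = xor-same b

isOdd≡false⇒even : ∀ n → isOdd n ≡ false → ∃ λ k → n ≡ 2 ℕ.* k
isOdd≡false⇒even zero          _ = 0 , refl
isOdd≡false⇒even (suc (suc n)) h with isOdd≡false⇒even n (trans (sym (not-involutive (isOdd n))) h)
... | k , refl = suc k , cong suc (sym (ℕP.+-suc k (k ℕ.+ 0)))

parity : ℤ → Bool
parity i = isOdd ∣ i ∣

parity-⊖ : ∀ m n → parity (m ⊖ n) ≡ isOdd m xor isOdd n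
parity-⊖ zero    zero    = refl
parity-⊖ (suc m) zero    = sym (xor-identityʳ (isOdd (suc m)))
parity-⊖ zero    (suc n) = refl
parity-⊖ (suc m) (suc n) = trans (cong parity (ℤP.[1+m]⊖[1+n]≡m⊖n m n))
  (trans (parity-⊖ m n) (sym (xor-annihilates-not (isOdd m) (isOdd n))))

parity-+ : ∀ i j → parity (i ℤ.+ j) ≡ parity i xor parity j
parity-+ (+ m)    (+ n)    = isOdd-+ m n
parity-+ (+ m)    -[1+ n ] = parity-⊖ m (suc n)
parity-+ -[1+ m ] (+ n)    = trans (parity-⊖ n (suc m)) (xor-comm (isOdd n) _)
parity-+ -[1+ m ] -[1+ n ] =
  trans (not-involutive (isOdd (m ℕ.+ n)))
        (trans (isOdd-+ m n) (sym (xor-annihilates-not (isOdd m) (isOdd n))))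

parity-* : ∀ i j → parity (i ℤ.* j) ≡ parity i ∧ parity j
parity-* i j = trans (cong isOdd (ℤP.abs-* i j)) (isOdd-* ∣ i ∣ ∣ j ∣)

parity-neg : ∀ i → parity (ℤ.- i) ≡ parity i
parity-neg i = cong isOdd (ℤP.∣-i∣≡∣i∣ i)

parity-- : ∀ i j → parity (i ℤ.- j) ≡ parity i xor parity j
parity-- i j = trans (parity-+ i (ℤ.- j)) (cong (parity i xor_) (parity-neg j))

parity≡false⇒even : ∀ i → parity i ≡ false → ∃ λ t → i ≡ + 2 ℤ.* t
parity≡false⇒even (+ n) h with isOdd≡false⇒even n h
... | k , refl = + k , ℤP.pos-* 2 k
parity≡false⇒even -[1+ n ] h with isOdd≡false⇒even (suc n) h
... | k , 1+n≡2k = ℤ.- (+ k) ,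
  trans (cong (λ m → ℤ.- (+ m)) 1+n≡2k) (trans (cong ℤ.-_ (ℤP.pos-* 2 k)) (ℤP.neg-distribʳ-* (+ 2) (+ k)))

fromBit : Bool → ℤ
fromBit false = 0ℤ
fromBit true  = 1ℤ

parity-fromBit : ∀ b → parity (fromBit b) ≡ b
parity-fromBit false = refl
parity-fromBit true  = refl

parity-∑ : ∀ r (f : F2 r → ℤ) → parity (ℤ[G].∑ r f) ≡ 𝔽₂[G].∑ r (parity ∘ f)
parity-∑ zero    f = refl
parity-∑ (suc r) f = trans (parity-+ (ℤ[G].∑ r (f ∘ (false ∷_))) _)
  (cong₂ _xor_ (parity-∑ r (f ∘ (false ∷_))) (parity-∑ r (f ∘ (true ∷_))))

parity-⋆ : ∀ {r} (a z : F2 r → ℤ) u → parity ((a ℤ[G].⋆ z) u) ≡ ((parity ∘ a) 𝔽₂[G].⋆ (parity ∘ z)) u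
parity-⋆ {r} a z u = trans (parity-∑ r _) (𝔽₂[G].∑-cong r (λ v → parity-* (a (u ⊕ v)) (z v)))

parity-δ : ∀ {r} (w : F2 r) → parity (ℤ[G].δ w) ≡ 𝔽₂[G].δ w
parity-δ w = if-float parity (isZero w)

parity-occurrences : ∀ {r k} (N : Vec (F2 r) k) w → parity (ℤ[G].occurrences N w) ≡ 𝔽₂[G].occurrences N w
parity-occurrences []      w = refl
parity-occurrences (m ∷ N) w =
  trans (parity-+ (ℤ[G].δ (m ⊕ w)) _) (cong₂ _xor_ (parity-δ (m ⊕ w)) (parity-occurrences N w))

even-lift : ∀ r (y : F2 r → Bool) → 𝔽₂[G].∑ r y ≡ false →
  ∃ λ (x : F2 r → ℤ) → ℤ[G].∑ r x ≡ 0ℤ × (∀ u → parity (x u) ≡ y u)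
even-lift r y ∑y≡0 = x , ∑x≡0 , parity-x
  where
  S : ℤ
  S = ℤ[G].∑ r (fromBit ∘ y)
  x : F2 r → ℤ
  x u = fromBit (y u) ℤ.+ ℤ.- (ℤ[G].δ u ℤ.* S)
  ∑x≡0 : ℤ[G].∑ r x ≡ 0ℤ
  ∑x≡0 = trans (ℤ[G].∑-distrib-+ r _ _) (trans
    (cong (λ t → S ℤ.+ t) (trans (ℤ[G].∑-neg r _) (cong ℤ.-_ (ℤ[G].∑-δ*₀ r (λ _ → S)))))
    (ℤP.+-inverseʳ S))
  parity-S : parity S ≡ false
  parity-S = trans (parity-∑ r (fromBit ∘ y)) (trans (𝔽₂[G].∑-cong r (parity-fromBit ∘ y)) ∑y≡0)
  parity-x : ∀ u → parity (x u) ≡ y u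
  parity-x u = begin
    parity (fromBit (y u) ℤ.+ ℤ.- (ℤ[G].δ u ℤ.* S))
      ≡⟨ parity-+ (fromBit (y u)) _ ⟩
    parity (fromBit (y u)) xor parity (ℤ.- (ℤ[G].δ u ℤ.* S))
      ≡⟨ cong₂ _xor_ (parity-fromBit (y u)) (trans (parity-neg (ℤ[G].δ u ℤ.* S)) (parity-* (ℤ[G].δ u) S)) ⟩
    y u xor (parity (ℤ[G].δ u) ∧ parity S)
      ≡⟨ cong (λ b → y u xor (parity (ℤ[G].δ u) ∧ b)) parity-S ⟩
    y u xor (parity (ℤ[G].δ u) ∧ false)
      ≡⟨ cong (y u xor_) (∧-zeroʳ _) ⟩
    y u xor false
      ≡⟨ xor-identityʳ (y u) ⟩
    y u ∎
    where open ≡-Reasoning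

-- The Laplacian as a convolution

sumℤ-++ : ∀ (xs ys : List ℤ) → sumℤ (xs ++ᴸ ys) ≡ sumℤ xs ℤ.+ sumℤ ys
sumℤ-++ []       ys = sym (ℤP.+-identityˡ _)
sumℤ-++ (x ∷ xs) ys = trans (cong (λ t → x ℤ.+ t) (sumℤ-++ xs ys)) (sym (ℤP.+-assoc x _ _))

sumℤ-allVecs : ∀ r (g : F2 r → ℤ) → sumℤ (map g (allVecs r)) ≡ ℤ[G].∑ r g
sumℤ-allVecs zero    g = ℤP.+-identityʳ (g [])
sumℤ-allVecs (suc r) g = begin
  sumℤ (map g (map (false ∷_) (allVecs r) ++ᴸ map (true ∷_) (allVecs r)))
    ≡⟨ cong sumℤ (map-++ g (map (false ∷_) (allVecs r)) _) ⟩
  sumℤ (map g (map (false ∷_) (allVecs r)) ++ᴸ map g (map (true ∷_) (allVecs r)))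
    ≡⟨ sumℤ-++ (map g (map (false ∷_) (allVecs r))) _ ⟩
  sumℤ (map g (map (false ∷_) (allVecs r))) ℤ.+ sumℤ (map g (map (true ∷_) (allVecs r)))
    ≡⟨ cong₂ ℤ._+_ (half false) (half true) ⟩
  ℤ[G].∑ (suc r) g ∎
  where
  open ≡-Reasoning
  half : ∀ b → sumℤ (map g (map (b ∷_) (allVecs r))) ≡ ℤ[G].∑ r (g ∘ (b ∷_))
  half b = trans (cong sumℤ (sym (map-∘ (allVecs r)))) (sumℤ-allVecs r (g ∘ (b ∷_)))

module Laplacian {r n : ℕ} (M : Vec (F2 r) n) where
  open ℤ[G]

  kernel : F2 r → ℤ
  kernel = lap M 𝟎

  mult-translate : ∀ {k} (N : Vec (F2 r) k) u v → mult N u v ≡ mult N 𝟎 (u ⊕ v)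
  mult-translate []      u v = refl
  mult-translate (m ∷ N) u v =
    cong₂ ℕ._+_ (cong (λ b → if b then 1 else 0) same-test) (mult-translate N u v)
    where
    same-test : does ((u ⊕ m) ≟V v) ≡ does ((𝟎 ⊕ m) ≟V (u ⊕ v))
    same-test = begin
      does ((u ⊕ m) ≟V v)       ≡⟨ does-≟V (u ⊕ m) v ⟩
      isZero ((u ⊕ m) ⊕ v)      ≡⟨ cong (λ x → isZero (x ⊕ v)) (⊕-comm u m) ⟩
      isZero ((m ⊕ u) ⊕ v)      ≡⟨ cong isZero (⊕-assoc m u v) ⟩
      isZero (m ⊕ (u ⊕ v))      ≡⟨ cong (λ x → isZero (x ⊕ (u ⊕ v))) (⊕-identityˡ m) ⟨
      isZero ((𝟎 ⊕ m) ⊕ (u ⊕ v)) ≡⟨ does-≟V (𝟎 ⊕ m) (u ⊕ v) ⟨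
      does ((𝟎 ⊕ m) ≟V (u ⊕ v)) ∎
      where open ≡-Reasoning

  lap-translate : ∀ u v → lap M u v ≡ kernel (u ⊕ v)
  lap-translate u v = cong₂ (λ b k → if b then + n else ℤ.- (+ k)) same-test (mult-translate M u v)
    where
    same-test : does (u ≟V v) ≡ does (𝟎 ≟V (u ⊕ v))
    same-test = trans (does-≟V u v)
      (trans (cong isZero (sym (⊕-identityˡ (u ⊕ v)))) (sym (does-≟V 𝟎 (u ⊕ v))))

  applyL≡⋆ : ∀ z u → applyL M z u ≡ (kernel ⋆ z) u
  applyL≡⋆ z u = trans (sumℤ-allVecs r _) (∑-cong r (λ v → cong (ℤ._* z v) (lap-translate u v)))

  mult≡occurrences : ∀ {k} (N : Vec (F2 r) k) w → + mult N 𝟎 w ≡ occurrences N w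
  mult≡occurrences []      w = refl
  mult≡occurrences (m ∷ N) w = begin
    + ((if does ((𝟎 ⊕ m) ≟V w) then 1 else 0) ℕ.+ mult N 𝟎 w)
      ≡⟨ ℤP.pos-+ _ (mult N 𝟎 w) ⟩
    + (if does ((𝟎 ⊕ m) ≟V w) then 1 else 0) ℤ.+ + mult N 𝟎 w
      ≡⟨ cong₂ ℤ._+_ (if-float +_ (does ((𝟎 ⊕ m) ≟V w))) (mult≡occurrences N w) ⟩
    (if does ((𝟎 ⊕ m) ≟V w) then 1ℤ else 0ℤ) ℤ.+ occurrences N w
      ≡⟨ cong (λ b → (if b then 1ℤ else 0ℤ) ℤ.+ occurrences N w)
           (trans (does-≟V (𝟎 ⊕ m) w) (cong (λ x → isZero (x ⊕ w)) (⊕-identityˡ m))) ⟩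
    δ (m ⊕ w) ℤ.+ occurrences N w ∎
    where open ≡-Reasoning

  occurrences-𝟎 : ∀ {k} (N : Vec (F2 r) k) → AllNonzero N → occurrences N 𝟎 ≡ 0ℤ
  occurrences-𝟎 []      _              = refl
  occurrences-𝟎 (m ∷ N) (m≢𝟎 , N≢𝟎) = cong₂ ℤ._+_
    (δ-nonzero (λ m⊕𝟎≡𝟎 → m≢𝟎 (trans (sym (⊕-identityʳ m)) m⊕𝟎≡𝟎))) (occurrences-𝟎 N N≢𝟎)

  kernel≡ : AllNonzero M → ∀ w → kernel w ≡ + n ℤ.* δ w ℤ.- occurrences M w
  kernel≡ M≢𝟎 w with 𝟎 ≟V w
  ... | yes refl rewrite isZero-𝟎 r | occurrences-𝟎 M M≢𝟎 =
    sym (trans (ℤP.+-identityʳ _) (ℤP.*-identityʳ (+ n)))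
  ... | no 𝟎≢w rewrite δ-nonzero (𝟎≢w ∘ sym) =
    trans (cong ℤ.-_ (mult≡occurrences M w))
      (sym (trans (cong (ℤ._- occurrences M w) (ℤP.*-zeroʳ (+ n))) (ℤP.+-identityˡ _)))

  applyL-linear : ∀ z c y u →
    applyL M (λ v → z v ℤ.+ c ℤ.* y v) u ≡ applyL M z u ℤ.+ c ℤ.* applyL M y u
  applyL-linear z c y u = begin
    applyL M (λ v → z v ℤ.+ c ℤ.* y v) u
      ≡⟨ applyL≡⋆ _ u ⟩
    (kernel ⋆ (λ v → z v ℤ.+ c ℤ.* y v)) u
      ≡⟨ ⋆-distribˡ kernel z _ u ⟩
    (kernel ⋆ z) u ℤ.+ (kernel ⋆ (λ v → c ℤ.* y v)) u
      ≡⟨ cong₂ ℤ._+_ (sym (applyL≡⋆ z u)) (⋆-*ʳ kernel y c u) ⟩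
    applyL M z u ℤ.+ c ℤ.* (kernel ⋆ y) u
      ≡⟨ cong (λ t → applyL M z u ℤ.+ c ℤ.* t) (applyL≡⋆ y u) ⟨
    applyL M z u ℤ.+ c ℤ.* applyL M y u ∎
    where open ≡-Reasoning

  InK-halve : ∀ {x y t} → InK M x → (∀ u → x u ≡ applyL M y u ℤ.+ + 2 ℤ.* t u) → InK M t
  InK-halve {x} {y} {t} (m , z , [1+m]x≡Lz) x≡Ly+2t = ℕ.pred (2 ℕ.* suc m) , z′ , λ u → begin
    + (2 ℕ.* suc m) ℤ.* t u                          ≡⟨ cong (ℤ._* t u) (ℤP.pos-* 2 (suc m)) ⟩
    (+ 2 ℤ.* + suc m) ℤ.* t u                        ≡⟨ regroup (+ suc m) (t u) ⟩
    + suc m ℤ.* (+ 2 ℤ.* t u)                        ≡⟨ cong (+ suc m ℤ.*_) (difference u) ⟩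
    + suc m ℤ.* (x u ℤ.- applyL M y u)               ≡⟨ distrib (+ suc m) (x u) (applyL M y u) ⟩
    + suc m ℤ.* x u ℤ.+ -[1+ m ] ℤ.* applyL M y u    ≡⟨ cong (ℤ._+ _) ([1+m]x≡Lz u) ⟩
    applyL M z u ℤ.+ -[1+ m ] ℤ.* applyL M y u       ≡⟨ applyL-linear z -[1+ m ] y u ⟨
    applyL M z′ u                                    ∎
    where
    open ≡-Reasoning
    z′ : ZVec r
    z′ v = z v ℤ.+ -[1+ m ] ℤ.* y v
    difference : ∀ u → + 2 ℤ.* t u ≡ x u ℤ.- applyL M y u
    difference u = sym (trans (cong (ℤ._- applyL M y u) (x≡Ly+2t u)) (cancel (applyL M y u) (+ 2 ℤ.* t u)))
      where
      cancel : ∀ a b → a ℤ.+ b ℤ.- a ≡ b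
      cancel = solve-∀
    regroup : ∀ c d → (+ 2 ℤ.* c) ℤ.* d ≡ c ℤ.* (+ 2 ℤ.* d)
    regroup = solve-∀
    distrib : ∀ c a b → c ℤ.* (a ℤ.- b) ≡ c ℤ.* a ℤ.+ ℤ.- c ℤ.* b
    distrib = solve-∀

-- Hadamard transform and the spectrum of the Laplacian

±1 : Bool → ℤ
±1 false = 1ℤ
±1 true  = -1ℤ

±1-xor : ∀ a b → ±1 (a xor b) ≡ ±1 a ℤ.* ±1 b
±1-xor false b     = sym (ℤP.*-identityˡ (±1 b))
±1-xor true  false = refl
±1-xor true  true  = refl

module Hadamard where
  open ℤ[G]

  χ : ∀ {r} → F2 r → F2 r → ℤ
  χ s u = ±1 (dot s u)

  χ-⊕ʳ : ∀ {r} (s u v : F2 r) → χ s (u ⊕ v) ≡ χ s u ℤ.* χ s v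
  χ-⊕ʳ s u v = trans (cong ±1 (dot-⊕ʳ s u v)) (±1-xor (dot s u) (dot s v))

  ∑-χ : ∀ r (u : F2 r) → ∑ r (λ s → χ s u) ≡ + (2 ^ r) ℤ.* δ u
  ∑-χ zero    []      = refl
  ∑-χ (suc r) (b ∷ u) = begin
    ∑ r (λ s → χ s u) ℤ.+ ∑ r (λ s → ±1 (b xor dot s u))
      ≡⟨ cong (λ t → ∑ r (λ s → χ s u) ℤ.+ t) (∑-cong r (λ s → ±1-xor b (dot s u))) ⟩
    ∑ r (λ s → χ s u) ℤ.+ ∑ r (λ s → ±1 b ℤ.* χ s u)
      ≡⟨ cong (λ t → ∑ r (λ s → χ s u) ℤ.+ t) (∑-*ˡ r (±1 b) (λ s → χ s u)) ⟩
    ∑ r (λ s → χ s u) ℤ.+ ±1 b ℤ.* ∑ r (λ s → χ s u)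
      ≡⟨ cong (λ t → t ℤ.+ ±1 b ℤ.* t) (∑-χ r u) ⟩
    + (2 ^ r) ℤ.* δ u ℤ.+ ±1 b ℤ.* (+ (2 ^ r) ℤ.* δ u)
      ≡⟨ doubling b ⟩
    + (2 ^ suc r) ℤ.* δ (b ∷ u) ∎
    where
    open ≡-Reasoning
    2^[1+r] : + (2 ^ suc r) ≡ + (2 ^ r) ℤ.+ + (2 ^ r)
    2^[1+r] = trans (cong (λ k → + (2 ^ r ℕ.+ k)) (ℕP.+-identityʳ (2 ^ r))) (ℤP.pos-+ (2 ^ r) (2 ^ r))
    doubling : ∀ b → + (2 ^ r) ℤ.* δ u ℤ.+ ±1 b ℤ.* (+ (2 ^ r) ℤ.* δ u) ≡ + (2 ^ suc r) ℤ.* δ (b ∷ u)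
    doubling false = trans (twice (+ (2 ^ r)) (δ u)) (cong (ℤ._* δ u) (sym 2^[1+r]))
      where
      twice : ∀ a d → a ℤ.* d ℤ.+ 1ℤ ℤ.* (a ℤ.* d) ≡ (a ℤ.+ a) ℤ.* d
      twice = solve-∀
    doubling true  = trans (cancel (+ (2 ^ r)) (δ u)) (sym (ℤP.*-zeroʳ (+ (2 ^ suc r))))
      where
      cancel : ∀ a d → a ℤ.* d ℤ.+ -1ℤ ℤ.* (a ℤ.* d) ≡ 0ℤ
      cancel = solve-∀

  hadamard : ∀ {r} → (F2 r → ℤ) → F2 r → ℤ
  hadamard {r} f s = ∑ r (λ u → χ s u ℤ.* f u)

  hadamard-cong : ∀ {r} {f g : F2 r → ℤ} → (∀ u → f u ≡ g u) → ∀ s → hadamard f s ≡ hadamard g s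
  hadamard-cong {r} f≗g s = ∑-cong r (λ u → cong (χ s u ℤ.*_) (f≗g u))

  hadamard-*ˡ : ∀ {r} (c : ℤ) (f : F2 r → ℤ) s → hadamard (λ u → c ℤ.* f u) s ≡ c ℤ.* hadamard f s
  hadamard-*ˡ {r} c f s = trans (∑-cong r (λ u → swap (χ s u) c (f u))) (∑-*ˡ r c _)
    where
    swap : ∀ a c b → a ℤ.* (c ℤ.* b) ≡ c ℤ.* (a ℤ.* b)
    swap = solve-∀

  hadamard-𝟎 : ∀ {r} (f : F2 r → ℤ) → hadamard f 𝟎 ≡ ∑ r f
  hadamard-𝟎 {r} f = ∑-cong r (λ u → trans (cong (λ b → ±1 b ℤ.* f u) (dot-𝟎ˡ u)) (ℤP.*-identityˡ (f u)))

  hadamard-involutive : ∀ {r} (f : F2 r → ℤ) u → hadamard (hadamard f) u ≡ + (2 ^ r) ℤ.* f u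
  hadamard-involutive {r} f u = begin
    ∑ r (λ s → χ u s ℤ.* ∑ r (λ v → χ s v ℤ.* f v))
      ≡⟨ ∑-cong r (λ s → sym (∑-*ˡ r (χ u s) _)) ⟩
    ∑ r (λ s → ∑ r (λ v → χ u s ℤ.* (χ s v ℤ.* f v)))
      ≡⟨ ∑-comm r r _ ⟩
    ∑ r (λ v → ∑ r (λ s → χ u s ℤ.* (χ s v ℤ.* f v)))
      ≡⟨ ∑-cong r (λ v → ∑-cong r (λ s → trans (sym (ℤP.*-assoc (χ u s) (χ s v) (f v)))
           (cong (ℤ._* f v) (trans (cong (λ b → ±1 b ℤ.* χ s v) (dot-comm u s)) (sym (χ-⊕ʳ s u v)))))) ⟩
    ∑ r (λ v → ∑ r (λ s → χ s (u ⊕ v) ℤ.* f v))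
      ≡⟨ ∑-cong r (λ v → trans (∑-*ʳ r (f v) _) (cong (ℤ._* f v) (∑-χ r (u ⊕ v)))) ⟩
    ∑ r (λ v → (+ (2 ^ r) ℤ.* δ (u ⊕ v)) ℤ.* f v)
      ≡⟨ ∑-cong r (λ v → ℤP.*-assoc (+ (2 ^ r)) (δ (u ⊕ v)) (f v)) ⟩
    ∑ r (λ v → + (2 ^ r) ℤ.* (δ (u ⊕ v) ℤ.* f v))
      ≡⟨ ∑-*ˡ r (+ (2 ^ r)) _ ⟩
    + (2 ^ r) ℤ.* ∑ r (λ v → δ (u ⊕ v) ℤ.* f v)
      ≡⟨ cong (+ (2 ^ r) ℤ.*_) (∑-δ* r u f) ⟩
    + (2 ^ r) ℤ.* f u ∎
    where open ≡-Reasoning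

  hadamard-injective : ∀ {r} {f g : F2 r → ℤ} → (∀ s → hadamard f s ≡ hadamard g s) → ∀ u → f u ≡ g u
  hadamard-injective {r} {f} {g} f̂≗ĝ u = ℤP.*-cancelˡ-≡ (+ (2 ^ r)) (f u) (g u) {{ℕP.m^n≢0 2 r}}
    (trans (sym (hadamard-involutive f u)) (trans (hadamard-cong f̂≗ĝ u) (hadamard-involutive g u)))

  hadamard-⋆ : ∀ {r} (a b : F2 r → ℤ) s → hadamard (a ⋆ b) s ≡ hadamard a s ℤ.* hadamard b s
  hadamard-⋆ {r} a b s = begin
    ∑ r (λ u → χ s u ℤ.* ∑ r (λ v → a (u ⊕ v) ℤ.* b v))
      ≡⟨ ∑-cong r (λ u → sym (∑-*ˡ r (χ s u) _)) ⟩
    ∑ r (λ u → ∑ r (λ v → χ s u ℤ.* (a (u ⊕ v) ℤ.* b v)))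
      ≡⟨ ∑-comm r r _ ⟩
    ∑ r (λ v → ∑ r (λ u → χ s u ℤ.* (a (u ⊕ v) ℤ.* b v)))
      ≡⟨ ∑-cong r (λ v → sym (∑-translate r _ v)) ⟩
    ∑ r (λ v → ∑ r (λ u → χ s (u ⊕ v) ℤ.* (a ((u ⊕ v) ⊕ v) ℤ.* b v)))
      ≡⟨ ∑-cong r (λ v → ∑-cong r (λ u → trans
           (cong₂ (λ c w → c ℤ.* (a w ℤ.* b v)) (χ-⊕ʳ s u v) (⊕-cancelʳ v u))
           (regroup (χ s u) (χ s v) (a u) (b v)))) ⟩
    ∑ r (λ v → ∑ r (λ u → (χ s u ℤ.* a u) ℤ.* (χ s v ℤ.* b v)))
      ≡⟨ ∑-cong r (λ v → ∑-*ʳ r _ _) ⟩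
    ∑ r (λ v → hadamard a s ℤ.* (χ s v ℤ.* b v))
      ≡⟨ ∑-*ˡ r (hadamard a s) _ ⟩
    hadamard a s ℤ.* hadamard b s ∎
    where
    open ≡-Reasoning
    regroup : ∀ p q x y → (p ℤ.* q) ℤ.* (x ℤ.* y) ≡ (p ℤ.* x) ℤ.* (q ℤ.* y)
    regroup = solve-∀

open Hadamard

oddCount : ∀ {r k} → F2 r → Vec (F2 r) k → ℕ
oddCount s []      = 0
oddCount s (m ∷ N) = (if dot s m then 1 else 0) ℕ.+ oddCount s N

oddCount-𝟎 : ∀ {r k} (N : Vec (F2 r) k) → oddCount 𝟎 N ≡ 0
oddCount-𝟎 []      = refl
oddCount-𝟎 (m ∷ N) rewrite dot-𝟎ˡ m = oddCount-𝟎 N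

oddCount-≤ : ∀ {r k} (s : F2 r) (N : Vec (F2 r) k) → oddCount s N ≤ k
oddCount-≤ s []      = ℕ.z≤n
oddCount-≤ s (m ∷ N) with dot s m
... | true  = ℕ.s≤s (oddCount-≤ s N)
... | false = ℕP.m≤n⇒m≤1+n (oddCount-≤ s N)

oddCount≡0⇒dot-subsetSum : ∀ {r k} (s : F2 r) (N : Vec (F2 r) k) → oddCount s N ≡ 0 →
  ∀ S → dot s (subsetSum S N) ≡ false
oddCount≡0⇒dot-subsetSum s []      _ []          = trans (dot-comm s 𝟎) (dot-𝟎ˡ s)
oddCount≡0⇒dot-subsetSum s (m ∷ N) h S           with dot s m in s·m
oddCount≡0⇒dot-subsetSum s (m ∷ N) h (true ∷ S)  | false =
  trans (dot-⊕ʳ s m (subsetSum S N)) (cong₂ _xor_ s·m (oddCount≡0⇒dot-subsetSum s N h S))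
oddCount≡0⇒dot-subsetSum s (m ∷ N) h (false ∷ S) | false = oddCount≡0⇒dot-subsetSum s N h S

generates⇒oddCount≢0 : ∀ {r n} (M : Vec (F2 r) n) → Generates M →
  ∀ s → ¬ s ≡ 𝟎 → ¬ oddCount s M ≡ 0
generates⇒oddCount≢0 M gen s s≢𝟎 oddCount≡0 with nonzero⇒∃dot≡true s s≢𝟎
... | w , s·w≡1 with gen w
... | S , refl with trans (sym s·w≡1) (oddCount≡0⇒dot-subsetSum s M oddCount≡0 S)
... | ()

n-∑±1≡2*oddCount : ∀ {r k} (s : F2 r) (N : Vec (F2 r) k) →
  + k ℤ.- ℤ[G].sumOver (χ s) N ≡ + (2 ℕ.* oddCount s N)
n-∑±1≡2*oddCount s []              = refl
n-∑±1≡2*oddCount {k = suc k} s (m ∷ N) = begin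
  + suc k ℤ.- (χ s m ℤ.+ ℤ[G].sumOver (χ s) N)
    ≡⟨ cong (ℤ._- (χ s m ℤ.+ ℤ[G].sumOver (χ s) N)) (ℤP.pos-+ 1 k) ⟩
  (1ℤ ℤ.+ + k) ℤ.- (χ s m ℤ.+ ℤ[G].sumOver (χ s) N)
    ≡⟨ rearrange 1ℤ (+ k) (χ s m) (ℤ[G].sumOver (χ s) N) ⟩
  (1ℤ ℤ.- χ s m) ℤ.+ (+ k ℤ.- ℤ[G].sumOver (χ s) N)
    ≡⟨ cong₂ ℤ._+_ (1-±1 (dot s m)) (n-∑±1≡2*oddCount s N) ⟩
  + (2 ℕ.* (if dot s m then 1 else 0)) ℤ.+ + (2 ℕ.* oddCount s N)
    ≡⟨ ℤP.pos-+ (2 ℕ.* (if dot s m then 1 else 0)) (2 ℕ.* oddCount s N) ⟨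
  + (2 ℕ.* (if dot s m then 1 else 0) ℕ.+ 2 ℕ.* oddCount s N)
    ≡⟨ cong +_ (ℕP.*-distribˡ-+ 2 (if dot s m then 1 else 0) (oddCount s N)) ⟨
  + (2 ℕ.* oddCount s (m ∷ N)) ∎
  where
  open ≡-Reasoning
  rearrange : ∀ a b c d → (a ℤ.+ b) ℤ.- (c ℤ.+ d) ≡ (a ℤ.- c) ℤ.+ (b ℤ.- d)
  rearrange = solve-∀
  1-±1 : ∀ b → 1ℤ ℤ.- ±1 b ≡ + (2 ℕ.* (if b then 1 else 0))
  1-±1 true  = refl
  1-±1 false = refl

module Spectrum {r n : ℕ} (M : Vec (F2 r) n) (M≢𝟎 : AllNonzero M) where
  open ℤ[G]
  open Laplacian M

  hadamard-kernel : ∀ s → hadamard kernel s ≡ + (2 ℕ.* oddCount s M)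
  hadamard-kernel s = begin
    ∑ r (λ w → χ s w ℤ.* kernel w)
      ≡⟨ ∑-cong r (λ w → trans (cong (χ s w ℤ.*_) (kernel≡ M≢𝟎 w))
                               (expand (χ s w) (+ n) (δ w) (occurrences M w))) ⟩
    ∑ r (λ w → δ w ℤ.* (+ n ℤ.* χ s w) ℤ.+ ℤ.- (occurrences M w ℤ.* χ s w))
      ≡⟨ trans (∑-distrib-+ r _ _) (cong (λ t → ∑ r (λ w → δ w ℤ.* (+ n ℤ.* χ s w)) ℤ.+ t) (∑-neg r _)) ⟩
    ∑ r (λ w → δ w ℤ.* (+ n ℤ.* χ s w)) ℤ.- ∑ r (λ w → occurrences M w ℤ.* χ s w)
      ≡⟨ cong₂ ℤ._-_ (∑-δ*₀ r (λ w → + n ℤ.* χ s w)) (∑-occurrences* r M (χ s)) ⟩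
    + n ℤ.* χ s 𝟎 ℤ.- sumOver (χ s) M
      ≡⟨ cong (λ b → + n ℤ.* ±1 b ℤ.- sumOver (χ s) M) (trans (dot-comm s 𝟎) (dot-𝟎ˡ s)) ⟩
    + n ℤ.* 1ℤ ℤ.- sumOver (χ s) M
      ≡⟨ cong (ℤ._- sumOver (χ s) M) (ℤP.*-identityʳ (+ n)) ⟩
    + n ℤ.- sumOver (χ s) M
      ≡⟨ n-∑±1≡2*oddCount s M ⟩
    + (2 ℕ.* oddCount s M) ∎
    where
    open ≡-Reasoning
    expand : ∀ c k d o → c ℤ.* (k ℤ.* d ℤ.- o) ≡ d ℤ.* (k ℤ.* c) ℤ.+ ℤ.- (o ℤ.* c)
    expand = solve-∀

  ∑-kernel : ∑ r kernel ≡ 0ℤ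
  ∑-kernel = trans (sym (hadamard-𝟎 kernel))
    (trans (hadamard-kernel 𝟎) (cong (λ c → + (2 ℕ.* c)) (oddCount-𝟎 M)))

  InK⇒∑≡0 : ∀ x → InK M x → ∑ r x ≡ 0ℤ
  InK⇒∑≡0 x (m , z , [1+m]x≡Lz) = ℤP.*-cancelˡ-≡ (+ suc m) (∑ r x) 0ℤ (begin
    + suc m ℤ.* ∑ r x                ≡⟨ ∑-*ˡ r (+ suc m) x ⟨
    ∑ r (λ u → + suc m ℤ.* x u)      ≡⟨ ∑-cong r (λ u → trans ([1+m]x≡Lz u) (applyL≡⋆ z u)) ⟩
    ∑ r (kernel ⋆ z)                 ≡⟨ ∑-⋆ r kernel z ⟩
    ∑ r kernel ℤ.* ∑ r z             ≡⟨ cong (ℤ._* ∑ r z) ∑-kernel ⟩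
    0ℤ ℤ.* ∑ r z                     ≡⟨ ℤP.*-zeroʳ (+ suc m) ⟨
    + suc m ℤ.* 0ℤ                   ∎)
    where open ≡-Reasoning

m≤n⇒m∣n! : ∀ m {n} .{{_ : NonZero m}} → m ≤ n → m ∣ n !
m≤n⇒m∣n! (suc m) m≤n = ∣-trans (m∣m*n (m !)) (m≤n⇒m!∣n! m≤n)

module Torsion {r n : ℕ} (M : Vec (F2 r) n) (M≢𝟎 : AllNonzero M) (gen : Generates M) where
  open ℤ[G]
  open Laplacian M
  open Spectrum M M≢𝟎

  -- a common multiple of the nonzero eigenvalues 2·oddCount s M ≤ 2n of the Laplacian
  D : ℕ
  D = (2 ℕ.* n) !

  eigenvalue∣D : ∀ s → ¬ s ≡ 𝟎 → ∃ λ q → hadamard kernel s ℤ.* q ≡ + D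
  eigenvalue∣D s s≢𝟎 with m≤n⇒m∣n! (2 ℕ.* oddCount s M) {{2c≢0}} (ℕP.*-monoʳ-≤ 2 (oddCount-≤ s M))
    where
    2c≢0 : NonZero (2 ℕ.* oddCount s M)
    2c≢0 = ℕP.m*n≢0 2 (oddCount s M) {{_}} {{ℕ.≢-nonZero (generates⇒oddCount≢0 M gen s s≢𝟎)}}
  ... | divides q D≡q*λ = + q , (begin
    hadamard kernel s ℤ.* + q           ≡⟨ cong (ℤ._* + q) (hadamard-kernel s) ⟩
    + (2 ℕ.* oddCount s M) ℤ.* + q      ≡⟨ ℤP.pos-* (2 ℕ.* oddCount s M) q ⟨
    + (2 ℕ.* oddCount s M ℕ.* q)        ≡⟨ cong +_ (trans (ℕP.*-comm _ q) (sym D≡q*λ)) ⟩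
    + D                                 ∎)
    where open ≡-Reasoning

  divide-by-kernel : ∀ x → ∑ r x ≡ 0ℤ →
    ∃ λ (ŵ : F2 r → ℤ) → ∀ s → hadamard kernel s ℤ.* ŵ s ≡ + D ℤ.* hadamard x s
  divide-by-kernel x ∑x≡0 = ŵ , scaled
    where
    q : F2 r → ℤ
    q s with s ≟V 𝟎
    ... | yes _   = 0ℤ
    ... | no s≢𝟎 = proj₁ (eigenvalue∣D s s≢𝟎)
    ŵ : F2 r → ℤ
    ŵ s = q s ℤ.* hadamard x s
    scaled : ∀ s → hadamard kernel s ℤ.* ŵ s ≡ + D ℤ.* hadamard x s
    scaled s with s ≟V 𝟎
    ... | yes refl rewrite hadamard-𝟎 x | ∑x≡0 = vanish (hadamard kernel 𝟎) (+ D)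
      where
      vanish : ∀ a d → a ℤ.* (0ℤ ℤ.* 0ℤ) ≡ d ℤ.* 0ℤ
      vanish = solve-∀
    ... | no s≢𝟎 = trans (sym (ℤP.*-assoc (hadamard kernel s) _ (hadamard x s)))
                      (cong (ℤ._* hadamard x s) (proj₂ (eigenvalue∣D s s≢𝟎)))

  ∑≡0⇒InK : ∀ x → ∑ r x ≡ 0ℤ → InK M x
  ∑≡0⇒InK x ∑x≡0 = ℕ.pred K , z , λ u → trans (hadamard-injective ĥ-agree u) (sym (applyL≡⋆ z u))
    where
    K : ℕ
    K = 2 ^ r ℕ.* D
    instance
      K≢0 : NonZero K
      K≢0 = ℕP.m*n≢0 (2 ^ r) D {{ℕP.m^n≢0 2 r}} {{(2 ℕ.* n) ℕP.!≢0}}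
    ŵ : F2 r → ℤ
    ŵ = proj₁ (divide-by-kernel x ∑x≡0)
    z : F2 r → ℤ
    z = hadamard ŵ
    ĥ-agree : ∀ s → hadamard (λ u → + suc (ℕ.pred K) ℤ.* x u) s ≡ hadamard (kernel ⋆ z) s
    ĥ-agree s = begin
      hadamard (λ u → + suc (ℕ.pred K) ℤ.* x u) s
        ≡⟨ hadamard-*ˡ (+ suc (ℕ.pred K)) x s ⟩
      + suc (ℕ.pred K) ℤ.* hadamard x s
        ≡⟨ cong (λ k → + k ℤ.* hadamard x s) (ℕP.suc-pred K) ⟩
      + (2 ^ r ℕ.* D) ℤ.* hadamard x s
        ≡⟨ trans (cong (ℤ._* hadamard x s) (ℤP.pos-* (2 ^ r) D)) (ℤP.*-assoc (+ (2 ^ r)) (+ D) _) ⟩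
      + (2 ^ r) ℤ.* (+ D ℤ.* hadamard x s)
        ≡⟨ cong (+ (2 ^ r) ℤ.*_) (proj₂ (divide-by-kernel x ∑x≡0) s) ⟨
      + (2 ^ r) ℤ.* (hadamard kernel s ℤ.* ŵ s)
        ≡⟨ swap (+ (2 ^ r)) (hadamard kernel s) (ŵ s) ⟩
      hadamard kernel s ℤ.* (+ (2 ^ r) ℤ.* ŵ s)
        ≡⟨ cong (hadamard kernel s ℤ.*_) (hadamard-involutive ŵ s) ⟨
      hadamard kernel s ℤ.* hadamard z s
        ≡⟨ hadamard-⋆ kernel z s ⟨
      hadamard (kernel ⋆ z) s ∎
      where
      open ≡-Reasoning
      swap : ∀ a b c → a ℤ.* (b ℤ.* c) ≡ b ℤ.* (a ℤ.* c)
      swap = solve-∀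

-- Reduction modulo 2

module ModTwo {s n : ℕ} (M : Vec (F2 (suc s)) n) (M≢𝟎 : AllNonzero M) (gen : Generates M)
  (j : Fin (suc s)) (∑M[j]≡1 : lookup (sumList M) j ≡ true) where
  open Laplacian M
  open Spectrum M M≢𝟎
  open Torsion M M≢𝟎 gen
  open 𝔽₂[G] using (∑; _⋆_; ⋆-congʳ)

  kernel₂ : F2 (suc s) → Bool
  kernel₂ = parity ∘ kernel

  parity-kernel : ∀ w → kernel₂ w ≡ (isOdd n ∧ 𝔽₂[G].δ w) xor 𝔽₂[G].occurrences M w
  parity-kernel w = begin
    parity (kernel w)
      ≡⟨ cong parity (kernel≡ M≢𝟎 w) ⟩
    parity (+ n ℤ.* ℤ[G].δ w ℤ.- ℤ[G].occurrences M w)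
      ≡⟨ parity-- (+ n ℤ.* ℤ[G].δ w) (ℤ[G].occurrences M w) ⟩
    parity (+ n ℤ.* ℤ[G].δ w) xor parity (ℤ[G].occurrences M w)
      ≡⟨ cong₂ _xor_ (parity-* (+ n) (ℤ[G].δ w)) (parity-occurrences M w) ⟩
    (isOdd n ∧ parity (ℤ[G].δ w)) xor 𝔽₂[G].occurrences M w
      ≡⟨ cong (λ b → (isOdd n ∧ b) xor 𝔽₂[G].occurrences M w) (parity-δ w) ⟩
    (isOdd n ∧ 𝔽₂[G].δ w) xor 𝔽₂[G].occurrences M w ∎
    where open ≡-Reasoning

  ∑-kernel₂ : ∑ (suc s) kernel₂ ≡ false
  ∑-kernel₂ = trans (sym (parity-∑ (suc s) kernel)) (cong parity ∑-kernel)

  ∑-kernel₂₁ : ∑ s (slice j true kernel₂) ≡ true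
  ∑-kernel₂₁ = begin
    ∑ s (slice j true kernel₂)
      ≡⟨ 𝔽₂[G].∑-cong s (λ u → trans (parity-kernel (insertAt u j true)) (off-𝟎 u)) ⟩
    ∑ s (slice j true (𝔽₂[G].occurrences M))
      ≡⟨ ∑-slice-true s j (𝔽₂[G].occurrences M) ⟩
    ∑ (suc s) (λ w → 𝔽₂[G].occurrences M w ∧ lookup w j)
      ≡⟨ 𝔽₂[G].∑-occurrences* (suc s) M (λ w → lookup w j) ⟩
    𝔽₂[G].sumOver (λ w → lookup w j) M
      ≡⟨ lookup-sumList M j ⟨
    lookup (sumList M) j
      ≡⟨ ∑M[j]≡1 ⟩
    true ∎
    where
    open ≡-Reasoning
    off-𝟎 : ∀ u → (isOdd n ∧ 𝔽₂[G].δ (insertAt u j true)) xor 𝔽₂[G].occurrences M (insertAt u j true)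
                 ≡ 𝔽₂[G].occurrences M (insertAt u j true)
    off-𝟎 u rewrite isZero-insertAt u j true | ∧-zeroʳ (isOdd n) = refl

  ∑-kernel₂₀ : ∑ s (slice j false kernel₂) ≡ true
  ∑-kernel₂₀ =
    trans (xor≡false⇒≡ (∑ s (slice j false kernel₂)) (∑ s (slice j true kernel₂)) halves) ∑-kernel₂₁
    where
    halves : ∑ s (slice j false kernel₂) xor ∑ s (slice j true kernel₂) ≡ false
    halves = trans (sym (𝔽₂[G].∑-slices s j kernel₂)) ∑-kernel₂

  open Splitting j kernel₂ ∑-kernel₂₀ ∑-kernel₂₁

  reduce : ZVec (suc s) → F2 (2 ^ s ∸ 1)
  reduce x = encode (Φ (parity ∘ x))

  parity-applyL : ∀ z u → parity (applyL M z u) ≡ (kernel₂ ⋆ (parity ∘ z)) u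
  parity-applyL z u = trans (cong parity (applyL≡⋆ z u)) (parity-⋆ kernel z u)

  reduce-+ : ∀ x y → reduce (x +ᶻ y) ≡ reduce x ⊕ reduce y
  reduce-+ x y = trans (encode-cong Φ-parity-+) (encode-xor (Φ (parity ∘ x)) (Φ (parity ∘ y)))
    where
    Φ-parity-+ : ∀ u → Φ (parity ∘ (x +ᶻ y)) u ≡ Φ (parity ∘ x) u xor Φ (parity ∘ y) u
    Φ-parity-+ u = trans (Φ-cong (λ w → parity-+ (x w) (y w)) u) (Φ-xor (parity ∘ x) (parity ∘ y) u)

  reduce-surjective : ∀ b → ∃ λ x → InK M x × reduce x ≡ b
  reduce-surjective b with encode-surjective s b
  ... | p , ∑p≡0 , encode-p≡b with even-lift (suc s) (glue j p (λ _ → false))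
                                  (trans (∑-glue s j p _) (cong₂ _xor_ ∑p≡0 (𝔽₂[G].∑-zero s)))
  ... | x , ∑x≡0 , parity-x =
    x , ∑≡0⇒InK x ∑x≡0 , trans (encode-cong (λ u → trans (Φ-cong parity-x u) (Φ-glue p u))) encode-p≡b

  reduce-annihilates : ∀ x → InIm+2K M x → reduce x ≡ 𝟎
  reduce-annihilates x (z , t , _ , x≡Lz+2t) =
    encode-false s (λ u → trans (Φ-cong parity-x u) (Φ-annihilates (parity ∘ z) u))
    where
    parity-x : ∀ w → parity (x w) ≡ (kernel₂ ⋆ (parity ∘ z)) w
    parity-x w = begin
      parity (x w)
        ≡⟨ cong parity (x≡Lz+2t w) ⟩
      parity (applyL M z w ℤ.+ + 2 ℤ.* t w)
        ≡⟨ parity-+ (applyL M z w) _ ⟩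
      parity (applyL M z w) xor parity (+ 2 ℤ.* t w)
        ≡⟨ cong₂ _xor_ (parity-applyL z w) (parity-* (+ 2) (t w)) ⟩
      (kernel₂ ⋆ (parity ∘ z)) w xor false
        ≡⟨ xor-identityʳ _ ⟩
      (kernel₂ ⋆ (parity ∘ z)) w ∎
      where open ≡-Reasoning

  reduce≡𝟎⇒InIm+2K : ∀ x → InK M x → reduce x ≡ 𝟎 → InIm+2K M x
  reduce≡𝟎⇒InIm+2K x x∈K reduce≡𝟎 = Q , t , InK-halve x∈K x≡LQ+2t , x≡LQ+2t
    where
    ∑Φ≡0 : ∑ s (Φ (parity ∘ x)) ≡ false
    ∑Φ≡0 = trans (∑-Φ (parity ∘ x)) (trans (sym (parity-∑ (suc s) x)) (cong parity (InK⇒∑≡0 x x∈K)))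
    preimage : ∃ λ q → ∀ w → (kernel₂ ⋆ q) w ≡ parity (x w)
    preimage = Φ≡0⇒∈a⋆ (parity ∘ x) (encode≡𝟎 (Φ (parity ∘ x)) ∑Φ≡0 reduce≡𝟎)
    Q : ZVec (suc s)
    Q = fromBit ∘ proj₁ preimage
    even : ∀ u → ∃ λ t → x u ℤ.- applyL M Q u ≡ + 2 ℤ.* t
    even u = parity≡false⇒even _ (begin
      parity (x u ℤ.- applyL M Q u)
        ≡⟨ parity-- (x u) (applyL M Q u) ⟩
      parity (x u) xor parity (applyL M Q u)
        ≡⟨ cong (parity (x u) xor_) (parity-applyL Q u) ⟩
      parity (x u) xor (kernel₂ ⋆ (parity ∘ Q)) u
        ≡⟨ cong (parity (x u) xor_) (⋆-congʳ kernel₂ (parity-fromBit ∘ proj₁ preimage) u) ⟩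
      parity (x u) xor (kernel₂ ⋆ proj₁ preimage) u
        ≡⟨ cong (parity (x u) xor_) (proj₂ preimage u) ⟩
      parity (x u) xor parity (x u)
        ≡⟨ xor-same (parity (x u)) ⟩
      false ∎)
      where open ≡-Reasoning
    t : ZVec (suc s)
    t u = proj₁ (even u)
    x≡LQ+2t : ∀ u → x u ≡ applyL M Q u ℤ.+ + 2 ℤ.* t u
    x≡LQ+2t u = trans (split (x u) (applyL M Q u)) (cong (λ d → applyL M Q u ℤ.+ d) (proj₂ (even u)))
      where
      split : ∀ a b → a ≡ b ℤ.+ (a ℤ.- b)
      split = solve-∀

  K⊗ℤ/2≅ : K⊗Z2≅ M (2 ^ s ∸ 1)
  K⊗ℤ/2≅ = reduce , (λ x y _ _ → reduce-+ x y) , reduce-surjective ,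
             λ x x∈K → reduce≡𝟎⇒InIm+2K x x∈K , reduce-annihilates x

mainTheorem1 : (r n : ℕ) → 1 ≤ r → (M : Vec (F2 r) n) →
    AllNonzero M → Generates M → ¬ (sumList M ≡ 𝟎) →
    K⊗Z2≅ M (2 ^ (r ∸ 1) ∸ 1)
mainTheorem1 (suc s) n _ M M≢𝟎 gen ∑M≢𝟎 with nonzero⇒∃lookup≡true (sumList M) ∑M≢𝟎
... | j , ∑M[j]≡1 = ModTwo.K⊗ℤ/2≅ M M≢𝟎 gen j ∑M[j]≡1
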